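{- Let $C$ be a linear code over $\mathbb{F}_q$ of length $n$, dimension $k$ and minimum distance $d$, with higher weights $d_1,\dots,d_k$. Assume that \[d_k=\frac{q^k-1}{q^{k-i}(q^i-1)}\,d_i\] for some $1\leq i<k$. Then $C$ is a constant weight code, and the common weight of its nonzero codewords is $d_k\frac{q^{k-1}(q-1)}{q^k-1}$.
   Context: A linear code $C$ is a subspace of $\mathbb{F}_q^n$ of dimension $k$. For a subcode (linear subspace) $D\subseteq C$, $\mathrm{Supp}(D)=\{x\in\{1,\dots,n\}: \exists\, c\in D,\ c_x\neq0\}$ and $w(D)=\#\mathrm{Supp}(D)$; the weight of a codeword is the weight of the subcode it spans. The higher weights are $d_r=\min\{w(D): D\subseteq C \text{ a subcode of dimension } r\}$ for $1\le r\le k$. A code is of constant weight if all nonzero codewords have the same weight. -}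

module Defs where

open import Level using (0ℓ)
open import Data.Nat using (ℕ; zero; suc)
open import Data.Fin using (Fin; zero; suc)
open import Data.Fin.Subset using (Subset; _∈_; ∣_∣)
open import Data.Product using (Σ; ∃; _×_; _,_)
open import Data.Empty using (⊥)
open import Relation.Nullary using (¬_)
open import Relation.Binary.PropositionalEquality using (_≡_; _≢_)
open import Algebra.Structures using (IsCommutativeRing)
open import Function.Bundles using (_⇔_; _↔_)

record FiniteField : Set₁ where
  infixl 6 _+_
  infixl 7 _*_
  field
    Carrier : Set
    _+_ _*_ : Carrier → Carrier → Carrier
    -_ : Carrier → Carrier
    0# 1# : Carrier
    isCommutativeRing : IsCommutativeRing _≡_ _+_ _*_ -_ 0# 1#
    0≢1 : 0# ≢ 1#
    inverse : ∀ x → x ≢ 0# → ∃ λ y → x * y ≡ 1#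
    q : ℕ
    enum : Carrier ↔ Fin q

module _ (F : FiniteField) where
  open FiniteField F

  Word : ℕ → Set
  Word n = Fin n → Carrier

  zeroW : ∀ {n} → Word n
  zeroW _ = 0#

  _≈W_ : ∀ {n} → Word n → Word n → Set
  u ≈W v = ∀ x → u x ≡ v x

  _+W_ : ∀ {n} → Word n → Word n → Word n
  (u +W v) x = u x + v x

  _·W_ : ∀ {n} → Carrier → Word n → Word n
  (a ·W v) x = a * v x

  lincomb : ∀ {r n} → (Fin r → Carrier) → (Fin r → Word n) → Word n
  lincomb {zero}  λs b = zeroW
  lincomb {suc r} λs b = (λs zero ·W b zero) +W lincomb (λ j → λs (suc j)) (λ j → b (suc j))

  InSpan : ∀ {r n} → (Fin r → Word n) → Word n → Set
  InSpan b v = ∃ λ λs → v ≈W lincomb λs b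

  LinIndep : ∀ {r n} → (Fin r → Word n) → Set
  LinIndep b = ∀ λs → lincomb λs b ≈W zeroW → ∀ j → λs j ≡ 0#

  -- A linear code C ⊆ F_q^n of dimension k, given by a basis (generator matrix rows)
  -- G : Fin k → Word n (linearly independent); C = span G.
  IsSubcodeBasis : ∀ {k n} → (G : Fin k → Word n) → (r : ℕ) → (Fin r → Word n) → Set
  IsSubcodeBasis G r b = (∀ j → InSpan G (b j)) × LinIndep b

  HasWeight : ∀ {n} → (Word n → Set) → ℕ → Set
  HasWeight {n} D m =
    Σ (Subset n) λ S → (∣ S ∣ ≡ m) × (∀ x → (x ∈ S) ⇔ (∃ λ c → D c × c x ≢ 0#))

  CodewordWeight : ∀ {n} → Word n → ℕ → Set
  CodewordWeight c m = HasWeight (InSpan {r = 1} (λ _ → c)) m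

  IsHigherWeight : ∀ {k n} → (G : Fin k → Word n) → (r m : ℕ) → Set
  IsHigherWeight G r m =
    (∃ λ b → IsSubcodeBasis G r b × HasWeight (InSpan b) m) ×
    (∀ b m' → IsSubcodeBasis G r b → HasWeight (InSpan b) m' → m Data.Nat.≤ m')

module Submission where

-- Work in coordinates with respect to the basis G and count ordered frames (tuples of independent
-- coordinate vectors) coordinate by coordinate. A frame misses a coordinate x of the support of C exactly
-- when it lies in the hyperplane {u : (uG)ₓ = 0}, and F_q^k and such a hyperplane contain
-- ∏ (q^k − q^j) and ∏ (q^(k−1) − q^j) frames of a given length. As dₖ is the size of the support (the
-- only k-dimensional subcode is C), the weights of all i-frames sum to dₖ (X − Y) with X, Y these two
-- counts; by hypothesis this is dᵢ X, the least value it can take, so every i-frame spans a subcode of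
-- weight exactly dᵢ. Repeating the count over the i-frames that start with a fixed nonzero codeword c,
-- in which every coordinate with cₓ ≠ 0 is covered, then determines the weight of c.

open import Defs
open import Algebra.Bundles using (CommutativeRing)
import Algebra.Properties.CommutativeSemigroup as CommutativeSemigroupProperties
import Algebra.Properties.Ring as RingProperties
open import Data.Fin.Base using (Fin; zero; suc)
import Data.Fin.Properties as Fin
open import Data.Nat.Base using (ℕ; zero; suc)
open import Data.Product.Base using (∃; _×_; _,_; proj₁; proj₂)
open import Function.Base using (_∘_)
open import Function.Bundles using (_⇔_; mk⇔; Equivalence; Inverse; Injection)
open import Function.Properties.Inverse using (↔⇒↣)
open import Relation.Binary.Definitions using (DecidableEquality)
open import Relation.Binary.PropositionalEquality hiding ([_])
open import Relation.Nullary using (¬_; Dec; yes; no; does; contradiction)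
open import Relation.Nullary.Decidable using (via-injection; dec-true; dec-false)

-- Linear combinations over a finite field

module LinearAlgebra (F : FiniteField) where
  open FiniteField F using (Carrier; _+_; _*_; -_; 0#; 1#; enum; isCommutativeRing; inverse)
  private
    ring : CommutativeRing _ _
    ring = record { isCommutativeRing = isCommutativeRing }
  open CommutativeRing ring
    using (+-assoc; +-comm; *-assoc; *-comm; distribˡ; distribʳ; zeroˡ; zeroʳ;
           +-identityˡ; +-identityʳ; *-identityˡ; *-identityʳ; -‿inverseʳ; -‿inverseˡ)
  open RingProperties (CommutativeRing.ring ring)
    using (-1*x≈-x; x∙y⁻¹≈ε⇒x≈y; +-inverseˡ-unique; -‿distribˡ-*; -‿distribʳ-*;
           \\-leftDividesˡ; \\-leftDividesʳ)

  open CommutativeSemigroupProperties (CommutativeRing.+-commutativeSemigroup ring)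
    using () renaming (interchange to +-interchange)

  private
    variable
      r n : ℕ

  infix 4 _≟_ _≈_
  _≈_ : Word F n → Word F n → Set
  _≈_ = _≈W_ F

  _≟_ : DecidableEquality Carrier
  _≟_ = via-injection (↔⇒↣ enum) Fin._≟_

  Supp : (Word F n → Set) → Fin n → Set
  Supp D x = ∃ λ c → D c × c x ≢ 0#

  lincomb-cong : ∀ {λs μs : Fin r → Carrier} {b c : Fin r → Word F n} →
                 (∀ j → λs j ≡ μs j) → (∀ j → b j ≈ c j) → lincomb F λs b ≈ lincomb F μs c
  lincomb-cong {zero}  λs≗μs b≈c x = refl
  lincomb-cong {suc r} λs≗μs b≈c x =
    cong₂ _+_ (cong₂ _*_ (λs≗μs zero) (b≈c zero x)) (lincomb-cong (λs≗μs ∘ suc) (b≈c ∘ suc) x)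

  lincomb-vanishes : ∀ (λs : Fin r → Carrier) (b : Fin r → Word F n) x →
                     (∀ j → b j x ≡ 0#) → lincomb F λs b x ≡ 0#
  lincomb-vanishes {zero}  λs b x b≡0 = refl
  lincomb-vanishes {suc r} λs b x b≡0 = begin
    λs zero * b zero x + lincomb F (λs ∘ suc) (b ∘ suc) x
      ≡⟨ cong₂ _+_ (cong (λs zero *_) (b≡0 zero)) (lincomb-vanishes (λs ∘ suc) (b ∘ suc) x (b≡0 ∘ suc)) ⟩
    λs zero * 0# + 0#  ≡⟨ +-identityʳ _ ⟩
    λs zero * 0#       ≡⟨ zeroʳ _ ⟩
    0#                 ∎
    where open ≡-Reasoning

  lincomb-zero : ∀ (b : Fin r → Word F n) → lincomb F (λ _ → 0#) b ≈ zeroW F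
  lincomb-zero {zero}  b x = refl
  lincomb-zero {suc r} b x =
    trans (cong₂ _+_ (zeroˡ (b zero x)) (lincomb-zero (b ∘ suc) x)) (+-identityˡ 0#)

  lincomb-+ : ∀ (λs μs : Fin r → Carrier) (b : Fin r → Word F n) x →
              lincomb F (λ j → λs j + μs j) b x ≡ lincomb F λs b x + lincomb F μs b x
  lincomb-+ {zero}  λs μs b x = sym (+-identityˡ 0#)
  lincomb-+ {suc r} λs μs b x = begin
    (λs zero + μs zero) * b zero x + lincomb F (λ j → λs (suc j) + μs (suc j)) (b ∘ suc) x
      ≡⟨ cong₂ _+_ (distribʳ (b zero x) (λs zero) (μs zero)) (lincomb-+ (λs ∘ suc) (μs ∘ suc) (b ∘ suc) x) ⟩
    (λs zero * b zero x + μs zero * b zero x) + (lincomb F (λs ∘ suc) (b ∘ suc) x + lincomb F (μs ∘ suc) (b ∘ suc) x)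
      ≡⟨ +-interchange _ _ _ _ ⟩
    (λs zero * b zero x + lincomb F (λs ∘ suc) (b ∘ suc) x) + (μs zero * b zero x + lincomb F (μs ∘ suc) (b ∘ suc) x)
      ∎
    where open ≡-Reasoning

  lincomb-* : ∀ c (λs : Fin r → Carrier) (b : Fin r → Word F n) x →
              lincomb F (λ j → c * λs j) b x ≡ c * lincomb F λs b x
  lincomb-* {zero}  c λs b x = sym (zeroʳ c)
  lincomb-* {suc r} c λs b x =
    trans (cong₂ _+_ (*-assoc c (λs zero) (b zero x)) (lincomb-* c (λs ∘ suc) (b ∘ suc) x))
          (sym (distribˡ c _ _))

  lincomb-lincomb : ∀ {k} (λs : Fin r → Carrier) (μ : Fin r → Word F k) (G : Fin k → Word F n) x →
                    lincomb F λs (λ l → lincomb F (μ l) G) x ≡ lincomb F (lincomb F λs μ) G x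
  lincomb-lincomb {zero}  λs μ G x = sym (lincomb-zero G x)
  lincomb-lincomb {suc r} λs μ G x = begin
    λs zero * lincomb F (μ zero) G x + lincomb F (λs ∘ suc) (λ l → lincomb F (μ (suc l)) G) x
      ≡⟨ cong₂ _+_ (sym (lincomb-* (λs zero) (μ zero) G x)) (lincomb-lincomb (λs ∘ suc) (μ ∘ suc) G x) ⟩
    lincomb F (λ j → λs zero * μ zero j) G x + lincomb F (lincomb F (λs ∘ suc) (μ ∘ suc)) G x
      ≡⟨ lincomb-+ _ _ G x ⟨
    lincomb F (lincomb F λs μ) G x
      ∎
    where open ≡-Reasoning

  unit : Fin r → Fin r → Carrier
  unit zero    zero    = 1#
  unit zero    (suc j) = 0#
  unit (suc l) zero    = 0#
  unit (suc l) (suc j) = unit l j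

  lincomb-unit : ∀ (l : Fin r) (b : Fin r → Word F n) → lincomb F (unit l) b ≈ b l
  lincomb-unit zero    b x =
    trans (cong₂ _+_ (*-identityˡ (b zero x)) (lincomb-zero (b ∘ suc) x)) (+-identityʳ (b zero x))
  lincomb-unit (suc l) b x =
    trans (cong₂ _+_ (zeroˡ (b zero x)) (lincomb-unit l (b ∘ suc) x)) (+-identityˡ (b (suc l) x))

  lincomb-injective : ∀ {b : Fin r → Word F n} → LinIndep F b → ∀ {λs μs} →
                      lincomb F λs b ≈ lincomb F μs b → ∀ j → λs j ≡ μs j
  lincomb-injective {b = b} indep {λs} {μs} same j = x∙y⁻¹≈ε⇒x≈y _ _ (indep _ difference≈0 j)
    where
    difference≈0 : lincomb F (λ j → λs j + - μs j) b ≈ zeroW F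
    difference≈0 x = begin
      lincomb F (λ j → λs j + - μs j) b x               ≡⟨ lincomb-+ λs _ b x ⟩
      lincomb F λs b x + lincomb F (λ j → - μs j) b x   ≡⟨ cong (λ s → lincomb F λs b x + s) negated ⟩
      lincomb F λs b x + - lincomb F μs b x             ≡⟨ cong (_+ - lincomb F μs b x) (same x) ⟩
      lincomb F μs b x + - lincomb F μs b x             ≡⟨ -‿inverseʳ _ ⟩
      0#                                                ∎
      where
      open ≡-Reasoning
      negated : lincomb F (λ j → - μs j) b x ≡ - lincomb F μs b x
      negated = begin
        lincomb F (λ j → - μs j) b x      ≡⟨ lincomb-cong (λ j → sym (-1*x≈-x (μs j))) (λ _ _ → refl) x ⟩
        lincomb F (λ j → - 1# * μs j) b x ≡⟨ lincomb-* (- 1#) μs b x ⟩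
        - 1# * lincomb F μs b x           ≡⟨ -1*x≈-x _ ⟩
        - lincomb F μs b x                ∎

  LinIndep-cons : ∀ (b : Fin (suc r) → Word F n) → LinIndep F (b ∘ suc) → ¬ InSpan F (b ∘ suc) (b zero) →
                  LinIndep F b
  LinIndep-cons b indep b₀∉span λs Σ≈0 with λs zero ≟ 0#
  ... | yes λ₀≡0 = λ { zero → λ₀≡0 ; (suc j) → indep (λs ∘ suc) tail≈0 j }
    where
    tail≈0 : lincomb F (λs ∘ suc) (b ∘ suc) ≈ zeroW F
    tail≈0 x = begin
      L x                      ≡⟨ +-identityˡ _ ⟨
      0# + L x                 ≡⟨ cong (_+ L x) (zeroˡ (b zero x)) ⟨
      0# * b zero x + L x      ≡⟨ cong (λ c → c * b zero x + L x) λ₀≡0 ⟨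
      λs zero * b zero x + L x ≡⟨ Σ≈0 x ⟩
      0#                       ∎
      where
      open ≡-Reasoning
      L = lincomb F (λs ∘ suc) (b ∘ suc)
  ... | no λ₀≢0 = contradiction ((λ j → - y * λs (suc j)) , b₀≈) b₀∉span
    where
    y = proj₁ (inverse (λs zero) λ₀≢0)
    L = lincomb F (λs ∘ suc) (b ∘ suc)
    -- dividing the relation λ₀ b₀ + L = 0 by λ₀ expresses b₀ through the tail
    b₀≈ : b zero ≈ lincomb F (λ j → - y * λs (suc j)) (b ∘ suc)
    b₀≈ x = begin
      b zero x                   ≡⟨ *-identityˡ _ ⟨
      1# * b zero x              ≡⟨ cong (_* b zero x) (trans (sym (proj₂ (inverse (λs zero) λ₀≢0))) (*-comm _ _)) ⟩
      (y * λs zero) * b zero x   ≡⟨ *-assoc y _ _ ⟩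
      y * (λs zero * b zero x)   ≡⟨ cong (y *_) (+-inverseˡ-unique _ _ (Σ≈0 x)) ⟩
      y * - L x                  ≡⟨ -‿distribʳ-* y (L x) ⟨
      - (y * L x)                ≡⟨ -‿distribˡ-* y (L x) ⟩
      - y * L x                  ≡⟨ lincomb-* (- y) (λs ∘ suc) (b ∘ suc) x ⟨
      lincomb F (λ j → - y * λs (suc j)) (b ∘ suc) x ∎
      where open ≡-Reasoning

  affine-uniqueSolution : ∀ {g} → g ≢ 0# → ∀ c t → ∃ λ a₀ → ∀ a → a * g + c ≡ t ⇔ a ≡ a₀
  affine-uniqueSolution {g} g≢0 c t = (- c + t) * y , λ a → mk⇔ (solve a) check
    where
    y = proj₁ (inverse g g≢0)
    g*y≡1 = proj₂ (inverse g g≢0)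
    solve : ∀ a → a * g + c ≡ t → a ≡ (- c + t) * y
    solve a eq = begin
      a                ≡⟨ *-identityʳ a ⟨
      a * 1#           ≡⟨ cong (a *_) g*y≡1 ⟨
      a * (g * y)      ≡⟨ *-assoc a g y ⟨
      (a * g) * y      ≡⟨ cong (_* y) ag≡ ⟩
      (- c + t) * y    ∎
      where
      open ≡-Reasoning
      ag≡ : a * g ≡ - c + t
      ag≡ = begin
        a * g                ≡⟨ \\-leftDividesʳ c (a * g) ⟨
        - c + (c + a * g)    ≡⟨ cong (λ z → - c + z) (trans (+-comm c (a * g)) eq) ⟩
        - c + t              ∎
    check : ∀ {a} → a ≡ (- c + t) * y → a * g + c ≡ t
    check refl = begin
      (- c + t) * y * g + c    ≡⟨ cong (_+ c) (trans (*-assoc _ y g) (cong ((- c + t) *_) (trans (*-comm y g) g*y≡1))) ⟩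
      (- c + t) * 1# + c       ≡⟨ cong (_+ c) (*-identityʳ _) ⟩
      (- c + t) + c            ≡⟨ +-comm _ c ⟩
      c + (- c + t)            ≡⟨ \\-leftDividesˡ c t ⟩
      t                        ∎
      where open ≡-Reasoning

  lincomb-dropHead : ∀ (λs : Fin (suc r) → Carrier) (g : Fin (suc r) → Word F n) x → g zero x ≡ 0# →
                     lincomb F λs g x ≡ lincomb F (λs ∘ suc) (g ∘ suc) x
  lincomb-dropHead λs g x g₀≡0 = begin
    λs zero * g zero x + L  ≡⟨ cong (λ c → λs zero * c + L) g₀≡0 ⟩
    λs zero * 0# + L        ≡⟨ cong (_+ L) (zeroʳ (λs zero)) ⟩
    0# + L                  ≡⟨ +-identityˡ L ⟩
    L                       ∎
    where
    open ≡-Reasoning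
    L = lincomb F (λs ∘ suc) (g ∘ suc) x

  Supp-InSpan⇔ : ∀ (b : Fin r → Word F n) x → Supp (InSpan F b) x ⇔ (∃ λ l → b l x ≢ 0#)
  Supp-InSpan⇔ {r} b x = mk⇔
    (λ (c , (λs , c≈) , cₓ≢0) → Fin.¬∀⟶∃¬ r _ (λ l → b l x ≟ 0#) λ all0 →
                                  cₓ≢0 (trans (c≈ x) (lincomb-vanishes λs b x all0)))
    (λ (l , bₗ≢0) → b l , (unit l , λ y → sym (lincomb-unit l b y)) , bₗ≢0)

-- Arithmetic on ℕ is imported only now, so that it does not clash with the field operations above.

open import Data.Nat.Base using (_+_; _*_; _∸_; _^_; _≤_; _<_; z≤n; s≤s; _≡ᵇ_; NonZero; >-nonZero)
import Data.Nat.Properties as ℕ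
open import Data.Nat.Tactic.RingSolver using (solve-∀)
open import Data.Integer.Base as ℤ using (ℤ; +_; 0ℤ; 1ℤ)
import Data.Integer.Properties as ℤ
open import Data.Integer.Tactic.RingSolver using () renaming (solve-∀ to ℤ-solve-∀)
open import Algebra.Properties.CommutativeMonoid.Sum ℕ.+-0-commutativeMonoid using (sum; sum-cong-≗; ∑-distrib-+; ∑-comm)
open import Algebra.Properties.Semiring.Sum ℕ.+-*-semiring using (*-distribˡ-sum; *-distribʳ-sum)
open import Data.Bool.Base using (Bool; true; false; _∧_; not)
open import Data.Bool.ListAction using (all)
open import Data.Bool.Properties using (∧-identityʳ; ∧-zeroʳ; T-≡; not-injective)
open import Data.Empty using (⊥)
open import Data.Fin.Subset using (Subset; ∣_∣)
open import Data.List.Base as List using (List; []; _∷_; [_]; length; _ʳ++_)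
open import Data.List.Properties using (length-ʳ++)
open import Data.Sum.Base using (inj₁; inj₂)
open import Data.Unit.Base using (⊤; tt)
open import Data.Vec.Base using (Vec; []; _∷_; lookup; tabulate)
open import Data.Vec.Properties using ([]=⇒lookup; lookup⇒[]=; lookup∘tabulate)

⟦_⟧ : Bool → ℕ
⟦ true ⟧  = 1
⟦ false ⟧ = 0

⟦∧⟧ : ∀ a b → ⟦ a ∧ b ⟧ ≡ ⟦ a ⟧ * ⟦ b ⟧
⟦∧⟧ true  b = sym (ℕ.+-identityʳ ⟦ b ⟧)
⟦∧⟧ false b = refl

⟦not⟧+⟦⟧ : ∀ a → ⟦ not a ⟧ + ⟦ a ⟧ ≡ 1
⟦not⟧+⟦⟧ true  = refl
⟦not⟧+⟦⟧ false = refl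

sum-const : ∀ n c → sum {n} (λ _ → c) ≡ n * c
sum-const zero    c = refl
sum-const (suc n) c = cong (λ s → c + s) (sum-const n c)

sum-mono : ∀ {n} {f g : Fin n → ℕ} → (∀ i → f i ≤ g i) → sum f ≤ sum g
sum-mono {zero}  f≤g = z≤n
sum-mono {suc n} f≤g = ℕ.+-mono-≤ (f≤g zero) (sum-mono (f≤g ∘ suc))

term≤sum : ∀ {n} (f : Fin n → ℕ) i → f i ≤ sum f
term≤sum f zero    = ℕ.m≤m+n _ _
term≤sum f (suc i) = ℕ.≤-trans (term≤sum (λ j → f (suc j)) i) (ℕ.m≤n+m _ _)

sum≢0⇒term≢0 : ∀ {n} (f : Fin n → ℕ) → sum f ≢ 0 → ∃ λ i → f i ≢ 0
sum≢0⇒term≢0 {zero}  f ≢0 = contradiction refl ≢0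
sum≢0⇒term≢0 {suc n} f ≢0 with f zero ℕ.≟ 0
... | no  f0≢0 = zero , f0≢0
... | yes f0≡0 with sum≢0⇒term≢0 (λ i → f (suc i)) (λ s≡0 → ≢0 (cong₂ _+_ f0≡0 s≡0))
...   | i , fi≢0 = suc i , fi≢0

∧-true : ∀ a b → a ∧ b ≡ true → a ≡ true × b ≡ true
∧-true true true refl = refl , refl

does≡true⇒ : ∀ {a} {A : Set a} (a? : Dec A) → does a? ≡ true → A
does≡true⇒ (yes a) _ = a

does≡false⇒ : ∀ {a} {A : Set a} (a? : Dec A) → does a? ≡ false → ¬ A
does≡false⇒ (no ¬a) _ = ¬a

does-cong : ∀ {a b} {A : Set a} {B : Set b} → A ⇔ B → (a? : Dec A) (b? : Dec B) → does a? ≡ does b?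
does-cong A⇔B (yes a) b? = sym (dec-true b? (Equivalence.to A⇔B a))
does-cong A⇔B (no ¬a) b? = sym (dec-false b? (¬a ∘ Equivalence.from A⇔B))

module _ {a} {A : Set a} {p : A → Bool} where

  all-lookup : ∀ (xs : List A) → all p xs ≡ true → ∀ i → p (List.lookup xs i) ≡ true
  all-lookup (x ∷ xs) eq zero    = proj₁ (∧-true (p x) _ eq)
  all-lookup (x ∷ xs) eq (suc i) = all-lookup xs (proj₂ (∧-true (p x) _ eq)) i

  all-true : (∀ x → p x ≡ true) → ∀ xs → all p xs ≡ true
  all-true p≡true []       = refl
  all-true p≡true (x ∷ xs) = cong₂ _∧_ (p≡true x) (all-true p≡true xs)

does≡false⇔ : ∀ {a} {A : Set a} (a? : Dec A) → does a? ≡ false ⇔ (¬ A)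
does≡false⇔ a? = mk⇔ (does≡false⇒ a?) (dec-false a?)

module _ {a} {A : Set a} (p : A → Bool) where

  not-all⇔ : ∀ (xs : List A) → not (all p xs) ≡ true ⇔ (∃ λ i → p (List.lookup xs i) ≡ false)
  not-all⇔ []       = mk⇔ (λ ()) (λ ())
  not-all⇔ (x ∷ xs) with p x in pₓ≡
  ... | false = mk⇔ (λ _ → zero , pₓ≡) (λ _ → refl)
  ... | true  = mk⇔ (λ eq → let i , pᵢ≡false = Equivalence.to (not-all⇔ xs) eq in suc i , pᵢ≡false)
                    (λ { (zero , pₓ≡false) → contradiction (trans (sym pₓ≡) pₓ≡false) λ ()
                       ; (suc i , pᵢ≡false) → Equivalence.from (not-all⇔ xs) (i , pᵢ≡false) })

∣∣≡sum : ∀ {n} (S : Subset n) → ∣ S ∣ ≡ sum (λ x → ⟦ lookup S x ⟧)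
∣∣≡sum []          = refl
∣∣≡sum (true ∷ S)  = cong suc (∣∣≡sum S)
∣∣≡sum (false ∷ S) = ∣∣≡sum S

true⇔⇒≡ : ∀ {a b} → a ≡ true ⇔ b ≡ true → a ≡ b
true⇔⇒≡ {true}  {true}  _ = refl
true⇔⇒≡ {false} {false} _ = refl
true⇔⇒≡ {true}  {false} a⇔b = sym (Equivalence.to a⇔b refl)
true⇔⇒≡ {false} {true}  a⇔b = Equivalence.from a⇔b refl

⟦⟧≢0⇒true : ∀ {a} → ⟦ a ⟧ ≢ 0 → a ≡ true
⟦⟧≢0⇒true {false} ≢0 = contradiction refl ≢0
⟦⟧≢0⇒true {true}  _  = refl

-- Counting frames

-- The number of ways to extend j independent vectors of an r-dimensional space over F_q by m further
-- vectors keeping independence: the next vector avoids a span of q^j elements.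
#extensions : ℕ → ℕ → ℕ → ℕ → ℕ
#extensions q r j zero    = 1
#extensions q r j (suc m) = (q ^ r ∸ q ^ j) * #extensions q r (suc j) m

⟦⟧-*-mono : ∀ a {x y} → (a ≡ true → x ≤ y) → ⟦ a ⟧ * x ≤ ⟦ a ⟧ * y
⟦⟧-*-mono false x≤y = z≤n
⟦⟧-*-mono true  x≤y = ℕ.*-monoʳ-≤ 1 (x≤y refl)

⟦⟧-interchange : ∀ a h c r x → ⟦ a ∧ r ⟧ * (⟦ h ∧ c ⟧ * x) ≡ ⟦ c ⟧ * (⟦ (a ∧ h) ∧ r ⟧ * x)
⟦⟧-interchange false h     c     r     x = sym (ℕ.*-zeroʳ ⟦ c ⟧)
⟦⟧-interchange true  false c     r     x = trans (ℕ.*-zeroʳ ⟦ r ⟧) (sym (ℕ.*-zeroʳ ⟦ c ⟧))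
⟦⟧-interchange true  true  c     false x = sym (ℕ.*-zeroʳ ⟦ c ⟧)
⟦⟧-interchange true  true  false true  x = refl
⟦⟧-interchange true  true  true  true  x = refl

module _ (q : ℕ) where

  #extensions-shift : ∀ r j m → #extensions q (suc r) (suc j) m ≡ q ^ m * #extensions q r j m
  #extensions-shift r j zero    = refl
  #extensions-shift r j (suc m) = begin
    (q ^ suc r ∸ q ^ suc j) * #extensions q (suc r) (suc (suc j)) m
      ≡⟨ cong₂ _*_ (sym (ℕ.*-distribˡ-∸ q (q ^ r) (q ^ j))) (#extensions-shift r (suc j) m) ⟩
    q * (q ^ r ∸ q ^ j) * (q ^ m * #extensions q r (suc j) m)
      ≡⟨ interchange q (q ^ r ∸ q ^ j) (q ^ m) (#extensions q r (suc j) m) ⟩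
    q * q ^ m * ((q ^ r ∸ q ^ j) * #extensions q r (suc j) m) ∎
    where
    open ≡-Reasoning
    interchange : ∀ a b c d → a * b * (c * d) ≡ a * c * (b * d)
    interchange = solve-∀

  #extensions-snoc : ∀ r j m → #extensions q r j (suc m) ≡ #extensions q r j m * (q ^ r ∸ q ^ (j + m))
  #extensions-snoc r j zero    = begin
    (q ^ r ∸ q ^ j) * 1        ≡⟨ ℕ.*-identityʳ _ ⟩
    q ^ r ∸ q ^ j              ≡⟨ cong (λ e → q ^ r ∸ q ^ e) (ℕ.+-identityʳ j) ⟨
    q ^ r ∸ q ^ (j + 0)        ≡⟨ ℕ.*-identityˡ _ ⟨
    1 * (q ^ r ∸ q ^ (j + 0))  ∎
    where open ≡-Reasoning
  #extensions-snoc r j (suc m) = begin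
    (q ^ r ∸ q ^ j) * #extensions q r (suc j) (suc m)
      ≡⟨ cong ((q ^ r ∸ q ^ j) *_) (#extensions-snoc r (suc j) m) ⟩
    (q ^ r ∸ q ^ j) * (#extensions q r (suc j) m * (q ^ r ∸ q ^ (suc j + m)))
      ≡⟨ ℕ.*-assoc (q ^ r ∸ q ^ j) _ _ ⟨
    (q ^ r ∸ q ^ j) * #extensions q r (suc j) m * (q ^ r ∸ q ^ (suc j + m))
      ≡⟨ cong (λ e → (q ^ r ∸ q ^ j) * #extensions q r (suc j) m * (q ^ r ∸ q ^ e)) (ℕ.+-suc j m) ⟨
    (q ^ r ∸ q ^ j) * #extensions q r (suc j) m * (q ^ r ∸ q ^ (j + suc m)) ∎
    where open ≡-Reasoning

  -- The ratio of the numbers of m-frames in a hyperplane and in the whole space.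
  #extensions-hyperplane : ∀ m s →
    #extensions q (m + s) 0 m * (q ^ suc (m + s) ∸ 1) ≡ #extensions q (suc (m + s)) 0 m * (q ^ suc s ∸ 1)
  #extensions-hyperplane zero      s = refl
  #extensions-hyperplane (suc m) s = begin
    #extensions q (suc m + s) 0 (suc m) * (K ∸ 1)
      ≡⟨ cong (_* (K ∸ 1)) (#extensions-snoc (suc m + s) 0 m) ⟩
    P * (q ^ (suc m + s) ∸ q ^ m) * (K ∸ 1)
      ≡⟨ cong (λ z → P * z * (K ∸ 1)) lastFactor ⟩
    P * (q ^ m * (q ^ suc s ∸ 1)) * (K ∸ 1)
      ≡⟨ rearrange P (q ^ m) (q ^ suc s ∸ 1) (K ∸ 1) ⟩
    (K ∸ 1) * (q ^ m * P) * (q ^ suc s ∸ 1)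
      ≡⟨ cong (λ z → (K ∸ 1) * z * (q ^ suc s ∸ 1)) (#extensions-shift (suc m + s) 0 m) ⟨
    #extensions q (suc (suc m + s)) 0 (suc m) * (q ^ suc s ∸ 1) ∎
    where
    open ≡-Reasoning
    K = q ^ suc (suc m + s)
    P = #extensions q (suc m + s) 0 m
    rearrange : ∀ a b c d → a * (b * c) * d ≡ d * (b * a) * c
    rearrange = solve-∀
    lastFactor : q ^ (suc m + s) ∸ q ^ m ≡ q ^ m * (q ^ suc s ∸ 1)
    lastFactor = begin
      q ^ (suc m + s) ∸ q ^ m              ≡⟨ cong (λ e → q ^ e ∸ q ^ m) (ℕ.+-suc m s) ⟨
      q ^ (m + suc s) ∸ q ^ m              ≡⟨ cong₂ _∸_ (ℕ.^-distribˡ-+-* q m (suc s)) (sym (ℕ.*-identityʳ (q ^ m))) ⟩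
      q ^ m * q ^ suc s ∸ q ^ m * 1        ≡⟨ ℕ.*-distribˡ-∸ (q ^ m) (q ^ suc s) 1 ⟨
      q ^ m * (q ^ suc s ∸ 1)              ∎

  #extensions-hyperplane₁ : ∀ m s →
    #extensions q (suc (m + s)) 1 m * (q ^ suc (m + s) ∸ 1) ≡ #extensions q (suc (suc (m + s))) 1 m * (q ^ suc s ∸ 1)
  #extensions-hyperplane₁ m s = begin
    #extensions q (suc (m + s)) 1 m * (q ^ suc (m + s) ∸ 1)
      ≡⟨ cong (_* (q ^ suc (m + s) ∸ 1)) (#extensions-shift (m + s) 0 m) ⟩
    q ^ m * #extensions q (m + s) 0 m * (q ^ suc (m + s) ∸ 1)
      ≡⟨ ℕ.*-assoc (q ^ m) _ _ ⟩
    q ^ m * (#extensions q (m + s) 0 m * (q ^ suc (m + s) ∸ 1))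
      ≡⟨ cong (q ^ m *_) (#extensions-hyperplane m s) ⟩
    q ^ m * (#extensions q (suc (m + s)) 0 m * (q ^ suc s ∸ 1))
      ≡⟨ ℕ.*-assoc (q ^ m) _ _ ⟨
    q ^ m * #extensions q (suc (m + s)) 0 m * (q ^ suc s ∸ 1)
      ≡⟨ cong (_* (q ^ suc s ∸ 1)) (#extensions-shift (suc (m + s)) 0 m) ⟨
    #extensions q (suc (suc (m + s))) 1 m * (q ^ suc s ∸ 1) ∎
    where open ≡-Reasoning

  #extensions≢0 : 1 < q → ∀ r j m → j + m ≤ r → #extensions q r j m ≢ 0
  #extensions≢0 1<q r j zero    _     = λ ()
  #extensions≢0 1<q r j (suc m) j+m<r eq with ℕ.m*n≡0⇒m≡0∨n≡0 (q ^ r ∸ q ^ j) eq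
  ... | inj₁ factor≡0 = ℕ.m<n⇒n≢0 (ℕ.m<n⇒0<n∸m (ℕ.^-monoʳ-< q 1<q j<r)) factor≡0
    where j<r = ℕ.m+n≤o⇒m≤o (suc j) (subst (_≤ r) (ℕ.+-suc j m) j+m<r)
  ... | inj₂ rest≡0   = #extensions≢0 1<q r (suc j) m (subst (_≤ r) (ℕ.+-suc j m) j+m<r) rest≡0

-- Solving for the weights

private
  *-≡0⇒≡0 : ∀ i j → j ≢ 0ℤ → i ℤ.* j ≡ 0ℤ → i ≡ 0ℤ
  *-≡0⇒≡0 i j j≢0 ij≡0 with ℤ.i*j≡0⇒i≡0∨j≡0 i ij≡0
  ... | inj₁ i≡0 = i≡0
  ... | inj₂ j≡0 = contradiction j≡0 j≢0

  *-≢0 : ∀ {i j} → i ≢ 0ℤ → j ≢ 0ℤ → i ℤ.* j ≢ 0ℤ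
  *-≢0 {i} i≢0 j≢0 ij≡0 with ℤ.i*j≡0⇒i≡0∨j≡0 i ij≡0
  ... | inj₁ i≡0 = i≢0 i≡0
  ... | inj₂ j≡0 = j≢0 j≡0

  vanish₃ : ∀ a b c {D₁ D₂ D₃} → D₁ ≡ 0ℤ → D₂ ≡ 0ℤ → D₃ ≡ 0ℤ →
            a ℤ.* D₁ ℤ.- b ℤ.* D₂ ℤ.+ c ℤ.* D₃ ≡ 0ℤ
  vanish₃ a b c refl refl refl = zeros a b c
    where
    zeros : ∀ a b c → a ℤ.* 0ℤ ℤ.- b ℤ.* 0ℤ ℤ.+ c ℤ.* 0ℤ ≡ 0ℤ
    zeros = ℤ-solve-∀

  vanish₄ : ∀ a b c d {D₁ D₂ D₃ D₄} → D₁ ≡ 0ℤ → D₂ ≡ 0ℤ → D₃ ≡ 0ℤ → D₄ ≡ 0ℤ →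
            a ℤ.* D₁ ℤ.- b ℤ.* D₂ ℤ.- c ℤ.* D₃ ℤ.+ d ℤ.* D₄ ≡ 0ℤ
  vanish₄ a b c d refl refl refl refl = zeros a b c d
    where
    zeros : ∀ a b c d → a ℤ.* 0ℤ ℤ.- b ℤ.* 0ℤ ℤ.- c ℤ.* 0ℤ ℤ.+ d ℤ.* 0ℤ ≡ 0ℤ
    zeros = ℤ-solve-∀

  certificate₁ : ∀ d dᵢ S X Y Qs Qi →
    (S ℤ.- dᵢ ℤ.* X) ℤ.* (Qs ℤ.* Qi ℤ.- 1ℤ)
    ≡ (Qs ℤ.* Qi ℤ.- 1ℤ) ℤ.* ((S ℤ.+ d ℤ.* Y) ℤ.- d ℤ.* X)
      ℤ.- d ℤ.* (Y ℤ.* (Qs ℤ.* Qi ℤ.- 1ℤ) ℤ.- X ℤ.* (Qs ℤ.- 1ℤ))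
      ℤ.+ X ℤ.* (d ℤ.* (Qs ℤ.* (Qi ℤ.- 1ℤ)) ℤ.- (Qs ℤ.* Qi ℤ.- 1ℤ) ℤ.* dᵢ)
  certificate₁ = ℤ-solve-∀

  certificate₂ : ∀ d dᵢ w Z M MH Qs q R →
    (w ℤ.* (q ℤ.* (Qs ℤ.* R) ℤ.- 1ℤ) ℤ.- d ℤ.* (Qs ℤ.* R ℤ.* (q ℤ.- 1ℤ))) ℤ.* ((Qs ℤ.- 1ℤ) ℤ.* M)
    ≡ (q ℤ.* (Qs ℤ.* R) ℤ.- 1ℤ) ℤ.* Z ℤ.* (MH ℤ.* (Qs ℤ.* R ℤ.- 1ℤ) ℤ.- M ℤ.* (Qs ℤ.- 1ℤ))
      ℤ.- (q ℤ.* (Qs ℤ.* R) ℤ.- 1ℤ) ℤ.* (Qs ℤ.* R ℤ.- 1ℤ) ℤ.* ((dᵢ ℤ.* M ℤ.+ Z ℤ.* MH) ℤ.- d ℤ.* M)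
      ℤ.- M ℤ.* (Qs ℤ.* R ℤ.- 1ℤ) ℤ.* (d ℤ.* (Qs ℤ.* (q ℤ.* R ℤ.- 1ℤ)) ℤ.- (q ℤ.* (Qs ℤ.* R) ℤ.- 1ℤ) ℤ.* dᵢ)
      ℤ.+ (q ℤ.* (Qs ℤ.* R) ℤ.- 1ℤ) ℤ.* (Qs ℤ.- 1ℤ) ℤ.* M ℤ.* ((w ℤ.+ Z) ℤ.- d)
  certificate₂ = ℤ-solve-∀

-- Each elimination multiplies the goal by a nonzero factor and writes the result as a combination of
-- the hypotheses (a certificate checked by the ring solver); ℤ is needed for the differences.
cancel-frameCountsℤ : ∀ d dᵢ S X Y Qs Qi → Qs ℤ.* Qi ℤ.- 1ℤ ≢ 0ℤ →
  S ℤ.+ d ℤ.* Y ≡ d ℤ.* X →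
  Y ℤ.* (Qs ℤ.* Qi ℤ.- 1ℤ) ≡ X ℤ.* (Qs ℤ.- 1ℤ) →
  d ℤ.* (Qs ℤ.* (Qi ℤ.- 1ℤ)) ≡ (Qs ℤ.* Qi ℤ.- 1ℤ) ℤ.* dᵢ →
  S ≡ dᵢ ℤ.* X
cancel-frameCountsℤ d dᵢ S X Y Qs Qi K≢0 h₁ h₂ h₃ =
  ℤ.i-j≡0⇒i≡j S (dᵢ ℤ.* X) (*-≡0⇒≡0 _ _ K≢0
    (trans (certificate₁ d dᵢ S X Y Qs Qi)
           (vanish₃ (Qs ℤ.* Qi ℤ.- 1ℤ) d X (ℤ.i≡j⇒i-j≡0 h₁) (ℤ.i≡j⇒i-j≡0 h₂) (ℤ.i≡j⇒i-j≡0 h₃))))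

solve-codewordWeightℤ : ∀ d dᵢ w Z M MH Qs q R → (Qs ℤ.- 1ℤ) ℤ.* M ≢ 0ℤ →
  dᵢ ℤ.* M ℤ.+ Z ℤ.* MH ≡ d ℤ.* M →
  w ℤ.+ Z ≡ d →
  MH ℤ.* (Qs ℤ.* R ℤ.- 1ℤ) ≡ M ℤ.* (Qs ℤ.- 1ℤ) →
  d ℤ.* (Qs ℤ.* (q ℤ.* R ℤ.- 1ℤ)) ≡ (q ℤ.* (Qs ℤ.* R) ℤ.- 1ℤ) ℤ.* dᵢ →
  w ℤ.* (q ℤ.* (Qs ℤ.* R) ℤ.- 1ℤ) ≡ d ℤ.* (Qs ℤ.* R ℤ.* (q ℤ.- 1ℤ))
solve-codewordWeightℤ d dᵢ w Z M MH Qs q R c≢0 h₁ h₂ h₃ h₄ =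
  ℤ.i-j≡0⇒i≡j _ _ (*-≡0⇒≡0 _ _ c≢0
    (trans (certificate₂ d dᵢ w Z M MH Qs q R)
           (vanish₄ ((q ℤ.* (Qs ℤ.* R) ℤ.- 1ℤ) ℤ.* Z) ((q ℤ.* (Qs ℤ.* R) ℤ.- 1ℤ) ℤ.* (Qs ℤ.* R ℤ.- 1ℤ))
                    (M ℤ.* (Qs ℤ.* R ℤ.- 1ℤ)) ((q ℤ.* (Qs ℤ.* R) ℤ.- 1ℤ) ℤ.* (Qs ℤ.- 1ℤ) ℤ.* M)
                    (ℤ.i≡j⇒i-j≡0 h₃) (ℤ.i≡j⇒i-j≡0 h₁) (ℤ.i≡j⇒i-j≡0 h₄) (ℤ.i≡j⇒i-j≡0 h₂))))

module _ {q : ℕ} (1<q : 1 < q) where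
  private
    instance
      q≢0 : NonZero q
      q≢0 = >-nonZero (ℕ.<-trans (s≤s z≤n) 1<q)

    ℤ[_] : ℕ → ℤ
    ℤ[ n ] = + (q ^ n)

    cast : ∀ a b c d → a * b ≡ c * d → + a ℤ.* + b ≡ + c ℤ.* + d
    cast a b c d eq = trans (sym (ℤ.pos-* a b)) (trans (cong +_ eq) (ℤ.pos-* c d))

    pos-∸1 : ∀ n → + (q ^ n ∸ 1) ≡ ℤ[ n ] ℤ.- 1ℤ
    pos-∸1 n = trans (sym (ℤ.⊖-≥ {q ^ n} {1} (ℕ.m^n>0 q n))) (sym (ℤ.m-n≡m⊖n (q ^ n) 1))

    pow-split : ∀ m n → ℤ[ suc (m + n) ] ≡ ℤ[ suc n ] ℤ.* ℤ[ m ]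
    pow-split m n = trans (cong (λ e → ℤ[ suc e ]) (ℕ.+-comm m n))
                          (trans (cong +_ (ℕ.^-distribˡ-+-* q (suc n) m)) (ℤ.pos-* (q ^ suc n) (q ^ m)))

    q^suc∸1≢0 : ∀ n → + (q ^ suc n ∸ 1) ≢ 0ℤ
    q^suc∸1≢0 n eq = ℕ.<⇒≢ (ℕ.m<n⇒0<n∸m (ℕ.^-monoʳ-< q 1<q {0} {suc n} (s≤s z≤n))) (sym (ℤ.+-injective eq))

  cancel-frameCounts : ∀ i s {d dᵢ S X Y} →
    S + d * Y ≡ d * X →
    Y * (q ^ suc (i + s) ∸ 1) ≡ X * (q ^ suc s ∸ 1) →
    d * (q ^ suc s * (q ^ i ∸ 1)) ≡ (q ^ suc (i + s) ∸ 1) * dᵢ →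
    S ≡ dᵢ * X
  cancel-frameCounts i s {d} {dᵢ} {S} {X} {Y} h₁ h₂ h₃ = ℤ.+-injective (trans
    (cancel-frameCountsℤ (+ d) (+ dᵢ) (+ S) (+ X) (+ Y) ℤ[ suc s ] ℤ[ i ]
      (λ eq → q^suc∸1≢0 (i + s) (trans K≡ eq)) h₁ℤ h₂ℤ h₃ℤ)
    (sym (ℤ.pos-* dᵢ X)))
    where
    K≡ : + (q ^ suc (i + s) ∸ 1) ≡ ℤ[ suc s ] ℤ.* ℤ[ i ] ℤ.- 1ℤ
    K≡ = trans (pos-∸1 (suc (i + s))) (cong (ℤ._- 1ℤ) (pow-split i s))
    h₁ℤ : + S ℤ.+ + d ℤ.* + Y ≡ + d ℤ.* + X
    h₁ℤ = trans (cong (λ z → + S ℤ.+ z) (sym (ℤ.pos-* d Y)))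
                (trans (sym (ℤ.pos-+ S (d * Y))) (trans (cong +_ h₁) (ℤ.pos-* d X)))
    h₂ℤ : + Y ℤ.* (ℤ[ suc s ] ℤ.* ℤ[ i ] ℤ.- 1ℤ) ≡ + X ℤ.* (ℤ[ suc s ] ℤ.- 1ℤ)
    h₂ℤ = trans (cong ((+ Y) ℤ.*_) (sym K≡)) (trans (cast Y _ X _ h₂) (cong ((+ X) ℤ.*_) (pos-∸1 (suc s))))
    h₃ℤ : + d ℤ.* (ℤ[ suc s ] ℤ.* (ℤ[ i ] ℤ.- 1ℤ)) ≡ (ℤ[ suc s ] ℤ.* ℤ[ i ] ℤ.- 1ℤ) ℤ.* + dᵢ
    h₃ℤ = trans (cong ((+ d) ℤ.*_) (trans (cong (ℤ[ suc s ] ℤ.*_) (sym (pos-∸1 i))) (sym (ℤ.pos-* (q ^ suc s) _))))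
                (trans (cast d _ (q ^ suc (i + s) ∸ 1) dᵢ h₃) (cong (ℤ._* + dᵢ) K≡))

  solve-codewordWeight : ∀ i′ s {d dᵢ w Z M MH} → M ≢ 0 →
    dᵢ * M + Z * MH ≡ d * M →
    w + Z ≡ d →
    MH * (q ^ suc (i′ + s) ∸ 1) ≡ M * (q ^ suc s ∸ 1) →
    d * (q ^ suc s * (q ^ suc i′ ∸ 1)) ≡ (q ^ suc (suc i′ + s) ∸ 1) * dᵢ →
    w * (q ^ suc (suc i′ + s) ∸ 1) ≡ d * (q ^ suc (i′ + s) * (q ∸ 1))
  solve-codewordWeight i′ s {d} {dᵢ} {w} {Z} {M} {MH} M≢0 h₁ h₂ h₃ h₄ = ℤ.+-injective (begin
    + (w * (q ^ suc (suc i′ + s) ∸ 1))        ≡⟨ trans (ℤ.pos-* w _) (cong ((+ w) ℤ.*_) K≡) ⟩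
    + w ℤ.* (+ q ℤ.* (Qs ℤ.* R) ℤ.- 1ℤ)       ≡⟨ solve-codewordWeightℤ (+ d) (+ dᵢ) (+ w) (+ Z) (+ M) (+ MH) Qs (+ q) R
                                                     (*-≢0 (q^suc∸1≢0 s ∘ trans (pos-∸1 (suc s))) (M≢0 ∘ ℤ.+-injective))
                                                     h₁ℤ h₂ℤ h₃ℤ h₄ℤ ⟩
    + d ℤ.* (Qs ℤ.* R ℤ.* (+ q ℤ.- 1ℤ))       ≡⟨ cong (λ z → + d ℤ.* (z ℤ.* (+ q ℤ.- 1ℤ))) K′≡ ⟨
    + d ℤ.* (ℤ[ suc (i′ + s) ] ℤ.* (+ q ℤ.- 1ℤ))
      ≡⟨ cong (λ z → + d ℤ.* (ℤ[ suc (i′ + s) ] ℤ.* z)) (trans (ℤ.m-n≡m⊖n q 1) (ℤ.⊖-≥ {q} {1} (ℕ.<⇒≤ 1<q))) ⟩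
    + d ℤ.* (ℤ[ suc (i′ + s) ] ℤ.* + (q ∸ 1)) ≡⟨ trans (ℤ.pos-* d _) (cong ((+ d) ℤ.*_) (ℤ.pos-* (q ^ suc (i′ + s)) (q ∸ 1))) ⟨
    + (d * (q ^ suc (i′ + s) * (q ∸ 1)))      ∎)
    where
    open ≡-Reasoning
    Qs = ℤ[ suc s ]
    R = ℤ[ i′ ]
    K′≡ : ℤ[ suc (i′ + s) ] ≡ Qs ℤ.* R
    K′≡ = pow-split i′ s
    K≡ : + (q ^ suc (suc i′ + s) ∸ 1) ≡ + q ℤ.* (Qs ℤ.* R) ℤ.- 1ℤ
    K≡ = trans (pos-∸1 (suc (suc i′ + s))) (cong (ℤ._- 1ℤ) (trans (ℤ.pos-* q _) (cong ((+ q) ℤ.*_) K′≡)))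
    h₁ℤ : + dᵢ ℤ.* + M ℤ.+ + Z ℤ.* + MH ≡ + d ℤ.* + M
    h₁ℤ = trans (cong₂ ℤ._+_ (sym (ℤ.pos-* dᵢ M)) (sym (ℤ.pos-* Z MH)))
                (trans (sym (ℤ.pos-+ (dᵢ * M) (Z * MH))) (trans (cong +_ h₁) (ℤ.pos-* d M)))
    h₂ℤ : + w ℤ.+ + Z ≡ + d
    h₂ℤ = trans (sym (ℤ.pos-+ w Z)) (cong +_ h₂)
    h₃ℤ : + MH ℤ.* (Qs ℤ.* R ℤ.- 1ℤ) ≡ + M ℤ.* (Qs ℤ.- 1ℤ)
    h₃ℤ = trans (cong ((+ MH) ℤ.*_) (sym (trans (pos-∸1 (suc (i′ + s))) (cong (ℤ._- 1ℤ) K′≡))))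
                (trans (cast MH _ M _ h₃) (cong ((+ M) ℤ.*_) (pos-∸1 (suc s))))
    h₄ℤ : + d ℤ.* (Qs ℤ.* (+ q ℤ.* R ℤ.- 1ℤ)) ≡ (+ q ℤ.* (Qs ℤ.* R) ℤ.- 1ℤ) ℤ.* + dᵢ
    h₄ℤ = trans (cong ((+ d) ℤ.*_) (trans (cong (λ z → Qs ℤ.* (z ℤ.- 1ℤ)) (sym (ℤ.pos-* q (q ^ i′))))
                                     (trans (cong (Qs ℤ.*_) (sym (pos-∸1 (suc i′)))) (sym (ℤ.pos-* (q ^ suc s) _)))))
                (trans (cast d _ (q ^ suc (suc i′ + s) ∸ 1) dᵢ h₄) (cong (ℤ._* + dᵢ) K≡))

module _ (F : FiniteField) where
  open FiniteField F using (Carrier; q; enum; 0#; 1#; 0≢1)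
  open Inverse enum using (to; from; strictlyInverseˡ; strictlyInverseʳ)
  open LinearAlgebra F

  1<q : 1 < q
  1<q = distinct⇒1< (to 0#) (to 1#) (0≢1 ∘ Injection.injective (↔⇒↣ enum))
    where
    distinct⇒1< : ∀ {m} (a b : Fin m) → a ≢ b → 1 < m
    distinct⇒1< {suc zero}    zero zero a≢b = contradiction refl a≢b
    distinct⇒1< {suc (suc m)} _    _    _   = s≤s (s≤s z≤n)

  ∑ᶜ : (Carrier → ℕ) → ℕ
  ∑ᶜ f = sum (f ∘ from)

  ∑ᶜ-cong : ∀ {f g : Carrier → ℕ} → (∀ a → f a ≡ g a) → ∑ᶜ f ≡ ∑ᶜ g
  ∑ᶜ-cong f≗g = sum-cong-≗ (f≗g ∘ from)

  term≤∑ᶜ : ∀ (f : Carrier → ℕ) a → f a ≤ ∑ᶜ f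
  term≤∑ᶜ f a = subst (λ b → f b ≤ ∑ᶜ f) (strictlyInverseʳ a) (term≤sum (f ∘ from) (to a))

  ∑ᶜ≢0⇒term≢0 : ∀ (f : Carrier → ℕ) → ∑ᶜ f ≢ 0 → ∃ λ a → f a ≢ 0
  ∑ᶜ≢0⇒term≢0 f ≢0 with sum≢0⇒term≢0 (f ∘ from) ≢0
  ... | i , fi≢0 = from i , fi≢0

  ∑ᶜ-δ : ∀ c → ∑ᶜ (λ a → ⟦ does (a ≟ c) ⟧) ≡ 1
  ∑ᶜ-δ c = trans (sum-cong-≗ same) (sum-δ (to c))
    where
    sum-δ : ∀ {m} (j : Fin m) → sum (λ i → ⟦ does (i Fin.≟ j) ⟧) ≡ 1
    sum-δ {suc m} zero    = cong suc (trans (sum-const m 0) (ℕ.*-zeroʳ m))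
    sum-δ {suc m} (suc j) = sum-δ j
    same : ∀ i → ⟦ does (from i ≟ c) ⟧ ≡ ⟦ does (i Fin.≟ to c) ⟧
    same i = cong (λ j → ⟦ does (j Fin.≟ to c) ⟧) (strictlyInverseˡ i)

  ∑ᵛ : ∀ k → (Vec Carrier k → ℕ) → ℕ
  ∑ᵛ zero    f = f []
  ∑ᵛ (suc k) f = ∑ᶜ λ a → ∑ᵛ k (f ∘ (a ∷_))

  ∑ᵛ-cong : ∀ k {f g : Vec Carrier k → ℕ} → (∀ u → f u ≡ g u) → ∑ᵛ k f ≡ ∑ᵛ k g
  ∑ᵛ-cong zero    f≗g = f≗g []
  ∑ᵛ-cong (suc k) f≗g = ∑ᶜ-cong λ a → ∑ᵛ-cong k (f≗g ∘ (a ∷_))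

  ∑ᵛ-distrib-+ : ∀ k (f g : Vec Carrier k → ℕ) → ∑ᵛ k (λ u → f u + g u) ≡ ∑ᵛ k f + ∑ᵛ k g
  ∑ᵛ-distrib-+ zero    f g = refl
  ∑ᵛ-distrib-+ (suc k) f g =
    trans (∑ᶜ-cong λ a → ∑ᵛ-distrib-+ k (f ∘ (a ∷_)) (g ∘ (a ∷_)))
          (∑-distrib-+ (λ i → ∑ᵛ k (f ∘ (from i ∷_))) (λ i → ∑ᵛ k (g ∘ (from i ∷_))))

  *-distribˡ-∑ᵛ : ∀ k c (f : Vec Carrier k → ℕ) → c * ∑ᵛ k f ≡ ∑ᵛ k (λ u → c * f u)
  *-distribˡ-∑ᵛ zero    c f = refl
  *-distribˡ-∑ᵛ (suc k) c f =
    trans (*-distribˡ-sum c (λ i → ∑ᵛ k (f ∘ (from i ∷_)))) (∑ᶜ-cong λ a → *-distribˡ-∑ᵛ k c (f ∘ (a ∷_)))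

  ∑ᵛ-const : ∀ k c → ∑ᵛ k (λ _ → c) ≡ q ^ k * c
  ∑ᵛ-const zero    c = sym (ℕ.*-identityˡ c)
  ∑ᵛ-const (suc k) c = begin
    ∑ᶜ (λ _ → ∑ᵛ k (λ _ → c))  ≡⟨ ∑ᶜ-cong {g = λ _ → q ^ k * c} (λ _ → ∑ᵛ-const k c) ⟩
    ∑ᶜ (λ _ → q ^ k * c)        ≡⟨ sum-const q (q ^ k * c) ⟩
    q * (q ^ k * c)             ≡⟨ ℕ.*-assoc q (q ^ k) c ⟨
    q ^ suc k * c               ∎
    where open ≡-Reasoning

  ∑ᵛ-mono : ∀ k {f g : Vec Carrier k → ℕ} → (∀ u → f u ≤ g u) → ∑ᵛ k f ≤ ∑ᵛ k g
  ∑ᵛ-mono zero    f≤g = f≤g []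
  ∑ᵛ-mono (suc k) f≤g = sum-mono λ i → ∑ᵛ-mono k (f≤g ∘ (from i ∷_))

  ∑ᵛ-comm-sum : ∀ k {n} (f : Vec Carrier k → Fin n → ℕ) →
                ∑ᵛ k (λ u → sum (f u)) ≡ sum (λ x → ∑ᵛ k (λ u → f u x))
  ∑ᵛ-comm-sum zero    f = refl
  ∑ᵛ-comm-sum (suc k) f =
    trans (∑ᶜ-cong λ a → ∑ᵛ-comm-sum k (f ∘ (a ∷_))) (∑-comm (λ i x → ∑ᵛ k (λ u → f (from i ∷ u) x)))

  ∑ᵛ-comm : ∀ k m (f : Vec Carrier k → Vec Carrier m → ℕ) →
            ∑ᵛ k (λ u → ∑ᵛ m (f u)) ≡ ∑ᵛ m (λ v → ∑ᵛ k (λ u → f u v))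
  ∑ᵛ-comm k zero    f = refl
  ∑ᵛ-comm k (suc m) f =
    trans (∑ᵛ-comm-sum k (λ u i → ∑ᵛ m (f u ∘ (from i ∷_))))
          (∑ᶜ-cong λ a → ∑ᵛ-comm k m (λ u → f u ∘ (a ∷_)))

  term≤∑ᵛ : ∀ k (f : Vec Carrier k → ℕ) u → f u ≤ ∑ᵛ k f
  term≤∑ᵛ zero    f []      = ℕ.≤-refl
  term≤∑ᵛ (suc k) f (a ∷ u) = ℕ.≤-trans (term≤∑ᵛ k (f ∘ (a ∷_)) u) (term≤∑ᶜ _ a)

  ∑ᵛ≢0⇒term≢0 : ∀ k (f : Vec Carrier k → ℕ) → ∑ᵛ k f ≢ 0 → ∃ λ u → f u ≢ 0
  ∑ᵛ≢0⇒term≢0 zero    f ≢0 = [] , ≢0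
  ∑ᵛ≢0⇒term≢0 (suc k) f ≢0 with ∑ᶜ≢0⇒term≢0 _ ≢0
  ... | a , ≢0′ with ∑ᵛ≢0⇒term≢0 k (f ∘ (a ∷_)) ≢0′
  ...   | u , fu≢0 = a ∷ u , fu≢0

  -- Σ (f - g) = 0 forces every difference to vanish.
  ∑ᵛ-≤-≡⇒≡ : ∀ k {f g : Vec Carrier k → ℕ} → (∀ u → g u ≤ f u) → ∑ᵛ k f ≡ ∑ᵛ k g →
             ∀ u → f u ≡ g u
  ∑ᵛ-≤-≡⇒≡ k {f} {g} g≤f Σf≡Σg u = ℕ.≤-antisym (ℕ.m∸n≡0⇒m≤n (ℕ.n≤0⇒n≡0 fu∸gu≤0)) (g≤f u)
    where
    Σdiff≡0 : ∑ᵛ k (λ v → f v ∸ g v) ≡ 0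
    Σdiff≡0 = ℕ.+-cancelˡ-≡ (∑ᵛ k g) _ 0 (begin
      ∑ᵛ k g + ∑ᵛ k (λ v → f v ∸ g v) ≡⟨ ∑ᵛ-distrib-+ k g _ ⟨
      ∑ᵛ k (λ v → g v + (f v ∸ g v))  ≡⟨ ∑ᵛ-cong k (λ v → ℕ.m+[n∸m]≡n (g≤f v)) ⟩
      ∑ᵛ k f                          ≡⟨ Σf≡Σg ⟩
      ∑ᵛ k g                          ≡⟨ ℕ.+-identityʳ _ ⟨
      ∑ᵛ k g + 0                      ∎)
      where open ≡-Reasoning
    fu∸gu≤0 : f u ∸ g u ≤ 0
    fu∸gu≤0 = subst (f u ∸ g u ≤_) Σdiff≡0 (term≤∑ᵛ k (λ v → f v ∸ g v) u)

  -- Pointwise equality tested coordinate by coordinate, so that ∑ᵛ-δ is a plain induction.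
  infix 5 _≈ᵇ_
  _≈ᵇ_ : ∀ {k} → Vec Carrier k → Word F k → Bool
  []      ≈ᵇ w = true
  (a ∷ u) ≈ᵇ w = does (a ≟ w zero) ∧ (u ≈ᵇ (w ∘ suc))

  ≈ᵇ-sound : ∀ {k} (u : Vec Carrier k) w → u ≈ᵇ w ≡ true → lookup u ≈ w
  ≈ᵇ-sound (a ∷ u) w eq with ∧-true (does (a ≟ w zero)) _ eq
  ... | a≡w₀ , u≈w = λ { zero → does≡true⇒ (a ≟ w zero) a≡w₀ ; (suc x) → ≈ᵇ-sound u (w ∘ suc) u≈w x }

  ≈ᵇ-complete : ∀ {k} (u : Vec Carrier k) w → lookup u ≈ w → u ≈ᵇ w ≡ true
  ≈ᵇ-complete []      w u≈w = refl
  ≈ᵇ-complete (a ∷ u) w u≈w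
    rewrite dec-true (a ≟ w zero) (u≈w zero) = ≈ᵇ-complete u (w ∘ suc) (u≈w ∘ suc)

  ∑ᵛ-δ : ∀ k (w : Word F k) → ∑ᵛ k (λ u → ⟦ u ≈ᵇ w ⟧) ≡ 1
  ∑ᵛ-δ zero    w = refl
  ∑ᵛ-δ (suc k) w = trans (∑ᶜ-cong component) (∑ᶜ-δ (w zero))
    where
    component : ∀ a → ∑ᵛ k (λ u → ⟦ does (a ≟ w zero) ∧ (u ≈ᵇ (w ∘ suc)) ⟧) ≡ ⟦ does (a ≟ w zero) ⟧
    component a = begin
      ∑ᵛ k (λ u → ⟦ a≟w₀ ∧ (u ≈ᵇ (w ∘ suc)) ⟧)  ≡⟨ ∑ᵛ-cong k (λ u → ⟦∧⟧ a≟w₀ (u ≈ᵇ (w ∘ suc))) ⟩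
      ∑ᵛ k (λ u → ⟦ a≟w₀ ⟧ * ⟦ u ≈ᵇ (w ∘ suc) ⟧) ≡⟨ *-distribˡ-∑ᵛ k ⟦ a≟w₀ ⟧ (λ u → ⟦ u ≈ᵇ (w ∘ suc) ⟧) ⟨
      ⟦ a≟w₀ ⟧ * ∑ᵛ k (λ u → ⟦ u ≈ᵇ (w ∘ suc) ⟧) ≡⟨ cong (⟦ a≟w₀ ⟧ *_) (∑ᵛ-δ k (w ∘ suc)) ⟩
      ⟦ a≟w₀ ⟧ * 1                               ≡⟨ ℕ.*-identityʳ _ ⟩
      ⟦ a≟w₀ ⟧                                   ∎
      where
      open ≡-Reasoning
      a≟w₀ = does (a ≟ w zero)

  module _ {n : ℕ} where

    HasWeight⇒≡sum : ∀ {D m} (p : Fin n → Bool) → (∀ x → Supp D x ⇔ p x ≡ true) →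
                     HasWeight F D m → m ≡ sum (⟦_⟧ ∘ p)
    HasWeight⇒≡sum p supp⇔p (S , ∣S∣≡m , ∈S⇔supp) = begin
      _                         ≡⟨ ∣S∣≡m ⟨
      ∣ S ∣                     ≡⟨ ∣∣≡sum S ⟩
      sum (λ x → ⟦ lookup S x ⟧) ≡⟨ sum-cong-≗ (cong ⟦_⟧ ∘ lookup≡p) ⟩
      sum (⟦_⟧ ∘ p)             ∎
      where
      open ≡-Reasoning
      lookup≡p : ∀ x → lookup S x ≡ p x
      lookup≡p x = true⇔⇒≡ (mk⇔ (Equivalence.to (supp⇔p x) ∘ Equivalence.to (∈S⇔supp x) ∘ lookup⇒[]= x S)
                                ([]=⇒lookup ∘ Equivalence.from (∈S⇔supp x) ∘ Equivalence.from (supp⇔p x)))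

    HasWeight-sum : ∀ {D} (p : Fin n → Bool) → (∀ x → Supp D x ⇔ p x ≡ true) → HasWeight F D (sum (⟦_⟧ ∘ p))
    HasWeight-sum p supp⇔p = tabulate p , ∣S∣≡ , λ x → mk⇔
        (Equivalence.from (supp⇔p x) ∘ trans (sym (lookup∘tabulate p x)) ∘ []=⇒lookup)
        (lookup⇒[]= x (tabulate p) ∘ trans (lookup∘tabulate p x) ∘ Equivalence.to (supp⇔p x))
      where
      ∣S∣≡ : ∣ tabulate p ∣ ≡ sum (⟦_⟧ ∘ p)
      ∣S∣≡ = trans (∣∣≡sum (tabulate p)) (sum-cong-≗ (cong ⟦_⟧ ∘ lookup∘tabulate p))

  -- Frames and their extensions

  -- Vectors of F_q^k are Vecs rather than functions so that sums over them range over canonical points.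
  module _ {k : ℕ} where

    Point : Set
    Point = Vec Carrier k

    family : (b : List Point) → Fin (length b) → Word F k
    family b = lookup ∘ List.lookup b

    rep : ∀ {j} → (Fin j → Word F k) → Point → ℕ
    rep {j} b u = ∑ᵛ j λ λs → ⟦ u ≈ᵇ lincomb F (lookup λs) b ⟧

    InSpan⇒rep≢0 : ∀ {j} (b : Fin j → Word F k) u → InSpan F b (lookup u) → rep b u ≢ 0
    InSpan⇒rep≢0 {j} b u (λs , u≈) rep≡0 = contradiction (subst (1 ≤_) rep≡0 1≤rep) λ ()
      where
      u≈′ : lookup u ≈ lincomb F (lookup (tabulate λs)) b
      u≈′ x = trans (u≈ x) (lincomb-cong (λ i → sym (lookup∘tabulate λs i)) (λ _ _ → refl) x)
      1≤rep : 1 ≤ rep b u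
      1≤rep = subst (λ a → ⟦ a ⟧ ≤ rep b u) (≈ᵇ-complete u _ u≈′)
                    (term≤∑ᵛ j (λ λs → ⟦ u ≈ᵇ lincomb F (lookup λs) b ⟧) (tabulate λs))

    rep≢0⇒InSpan : ∀ {j} (b : Fin j → Word F k) u → rep b u ≢ 0 → InSpan F b (lookup u)
    rep≢0⇒InSpan {j} b u rep≢0 with ∑ᵛ≢0⇒term≢0 j _ rep≢0
    ... | λs , term≢0 = lookup λs , ≈ᵇ-sound u _ (⟦⟧≢0⇒true term≢0)

    rep≤1 : ∀ {j} (b : Fin j → Word F k) → LinIndep F b → ∀ u → rep b u ≤ 1
    rep≤1 {j} b indep u with rep b u ℕ.≟ 0
    ... | yes rep≡0 = ℕ.≤-trans (ℕ.≤-reflexive rep≡0) z≤n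
    ... | no  rep≢0 with rep≢0⇒InSpan b u rep≢0
    ...   | λ₀ , u≈λ₀ = ℕ.≤-trans (∑ᵛ-mono j term≤δ) (ℕ.≤-reflexive (∑ᵛ-δ j λ₀))
      where
      term≤δ : ∀ λs → ⟦ u ≈ᵇ lincomb F (lookup λs) b ⟧ ≤ ⟦ λs ≈ᵇ λ₀ ⟧
      term≤δ λs with u ≈ᵇ lincomb F (lookup λs) b in eq
      ... | false = z≤n
      ... | true  = ℕ.≤-reflexive (cong ⟦_⟧ (sym (≈ᵇ-complete λs λ₀
                      (lincomb-injective indep λ x → trans (sym (≈ᵇ-sound u _ eq x)) (u≈λ₀ x)))))

    ∑rep : ∀ {j} (b : Fin j → Word F k) → ∑ᵛ k (rep b) ≡ q ^ j
    ∑rep {j} b = begin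
      ∑ᵛ k (λ u → ∑ᵛ j λ λs → ⟦ u ≈ᵇ lincomb F (lookup λs) b ⟧)
        ≡⟨ ∑ᵛ-comm k j _ ⟩
      ∑ᵛ j (λ λs → ∑ᵛ k λ u → ⟦ u ≈ᵇ lincomb F (lookup λs) b ⟧)
        ≡⟨ ∑ᵛ-cong j (λ λs → ∑ᵛ-δ k _) ⟩
      ∑ᵛ j (λ _ → 1)
        ≡⟨ ∑ᵛ-const j 1 ⟩
      q ^ j * 1
        ≡⟨ ℕ.*-identityʳ _ ⟩
      q ^ j ∎
      where open ≡-Reasoning

    -- Independence makes the q^k combinations pairwise distinct, so they exhaust all q^k points.
    LinIndep⇒spanning : ∀ (b : Fin k → Word F k) → LinIndep F b → ∀ w → InSpan F b w
    LinIndep⇒spanning b indep w with rep≢0⇒InSpan b (tabulate w) rep≢0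
      where
      rep≡1 : ∀ u → 1 ≡ rep b u
      rep≡1 = ∑ᵛ-≤-≡⇒≡ k (rep≤1 b indep) (trans (∑ᵛ-const k 1) (trans (ℕ.*-identityʳ _) (sym (∑rep b))))
      rep≢0 : rep b (tabulate w) ≢ 0
      rep≢0 rep≡0 = contradiction (trans (rep≡1 (tabulate w)) rep≡0) λ ()
    ... | λs , w≈ = λs , λ x → trans (sym (lookup∘tabulate w x)) (w≈ x)

    Subspace : (Point → Bool) → Set
    Subspace V = ∀ b u → all V b ≡ true → InSpan F (family b) (lookup u) → V u ≡ true

    wholeSpace : Point → Bool
    wholeSpace _ = true

    admissible : (Point → Bool) → List Point → Point → Bool
    admissible V b u = V u ∧ (rep (family b) u ≡ᵇ 0)

    admissible⇒ : ∀ V b u → admissible V b u ≡ true → V u ≡ true × ¬ InSpan F (family b) (lookup u)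
    admissible⇒ V b u eq with ∧-true (V u) _ eq
    ... | Vu , rep≡ᵇ0 =
      Vu , λ inSpan → InSpan⇒rep≢0 (family b) u inSpan (ℕ.≡ᵇ⇒≡ _ 0 (Equivalence.from T-≡ rep≡ᵇ0))

    ¬InSpan⇒admissible : ∀ V b u → V u ≡ true → ¬ InSpan F (family b) (lookup u) → admissible V b u ≡ true
    ¬InSpan⇒admissible V b u Vu u∉span with rep (family b) u in rep≡
    ... | zero  = trans (∧-identityʳ (V u)) Vu
    ... | suc _ = contradiction (rep≢0⇒InSpan (family b) u λ rep≡0 → contradiction (trans (sym rep≡) rep≡0) λ ()) u∉span

    admissible+rep : ∀ {V} → Subspace V → ∀ b → LinIndep F (family b) → all V b ≡ true →
                     ∀ u → ⟦ admissible V b u ⟧ + rep (family b) u ≡ ⟦ V u ⟧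
    admissible+rep {V} V-closed b indep b⊆V u with rep (family b) u in rep≡ | rep≤1 (family b) indep u
    ... | zero        | _ = trans (ℕ.+-identityʳ _) (cong ⟦_⟧ (∧-identityʳ (V u)))
    ... | suc zero    | _ rewrite ∧-zeroʳ (V u) = cong ⟦_⟧ (sym (V-closed b u b⊆V inSpan))
      where inSpan = rep≢0⇒InSpan (family b) u λ rep≡0 → contradiction (trans (sym rep≡) rep≡0) λ ()
    ... | suc (suc _) | s≤s ()

    ∑ᵛ-admissible : ∀ {V r} → Subspace V → ∑ᵛ k (⟦_⟧ ∘ V) ≡ q ^ r → ∀ b → LinIndep F (family b) →
                    all V b ≡ true → ∑ᵛ k (λ u → ⟦ admissible V b u ⟧) ≡ q ^ r ∸ q ^ length b
    ∑ᵛ-admissible {V} {r} V-closed #V b indep b⊆V = begin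
      ∑ᵛ k (λ u → ⟦ admissible V b u ⟧)                          ≡⟨ ℕ.m+n∸n≡m _ (q ^ length b) ⟨
      ∑ᵛ k (λ u → ⟦ admissible V b u ⟧) + q ^ length b ∸ q ^ length b
        ≡⟨ cong (λ s → ∑ᵛ k (λ u → ⟦ admissible V b u ⟧) + s ∸ q ^ length b) (∑rep (family b)) ⟨
      ∑ᵛ k (λ u → ⟦ admissible V b u ⟧) + ∑ᵛ k (rep (family b)) ∸ q ^ length b
        ≡⟨ cong (_∸ q ^ length b) (∑ᵛ-distrib-+ k _ (rep (family b))) ⟨
      ∑ᵛ k (λ u → ⟦ admissible V b u ⟧ + rep (family b) u) ∸ q ^ length b
        ≡⟨ cong (_∸ q ^ length b) (trans (∑ᵛ-cong k (admissible+rep V-closed b indep b⊆V)) #V) ⟩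
      q ^ r ∸ q ^ length b                                          ∎
      where open ≡-Reasoning

    -- ∑Ext V m b Φ sums Φ over all ways of extending the frame b, kept newest first, by m vectors of V,
    -- each outside the span of the vectors before it; Extends V m b e says e is such an extension.
    ∑Ext : (Point → Bool) → ℕ → List Point → (List Point → ℕ) → ℕ
    ∑Ext V zero    b Φ = Φ b
    ∑Ext V (suc m) b Φ = ∑ᵛ k λ u → ⟦ admissible V b u ⟧ * ∑Ext V m (u ∷ b) Φ

    Extends : (Point → Bool) → ℕ → List Point → List Point → Set
    Extends V zero    b []      = ⊤
    Extends V (suc m) b (u ∷ e) = admissible V b u ≡ true × Extends V m (u ∷ b) e
    Extends V _       _ _       = ⊥

    Extends⇒length : ∀ {V} m {b} e → Extends V m b e → length e ≡ m
    Extends⇒length zero    []      _         = refl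
    Extends⇒length (suc m) (u ∷ e) (_ , ext) = cong suc (Extends⇒length m e ext)

    Extends⇒LinIndep : ∀ {V} m {b} e → LinIndep F (family b) → Extends V m b e → LinIndep F (family (e ʳ++ b))
    Extends⇒LinIndep zero    []      indep _           = indep
    Extends⇒LinIndep {V} (suc m) {b} (u ∷ e) indep (adm , ext) =
      Extends⇒LinIndep m e (LinIndep-cons (family (u ∷ b)) indep (proj₂ (admissible⇒ V b u adm))) ext

    ∑Ext-cong : ∀ V m b {Φ Ψ : List Point → ℕ} → (∀ t → Φ t ≡ Ψ t) → ∑Ext V m b Φ ≡ ∑Ext V m b Ψ
    ∑Ext-cong V zero    b Φ≗Ψ = Φ≗Ψ b
    ∑Ext-cong V (suc m) b Φ≗Ψ = ∑ᵛ-cong k λ u → cong (⟦ admissible V b u ⟧ *_) (∑Ext-cong V m (u ∷ b) Φ≗Ψ)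

    *-distribˡ-∑Ext : ∀ V m b c (Φ : List Point → ℕ) → c * ∑Ext V m b Φ ≡ ∑Ext V m b (λ t → c * Φ t)
    *-distribˡ-∑Ext V zero    b c Φ = refl
    *-distribˡ-∑Ext V (suc m) b c Φ = trans (*-distribˡ-∑ᵛ k c _) (∑ᵛ-cong k λ u → begin
      c * (⟦ admissible V b u ⟧ * ∑Ext V m (u ∷ b) Φ)  ≡⟨ ℕ.*-assoc c _ _ ⟨
      c * ⟦ admissible V b u ⟧ * ∑Ext V m (u ∷ b) Φ    ≡⟨ cong (_* ∑Ext V m (u ∷ b) Φ) (ℕ.*-comm c _) ⟩
      ⟦ admissible V b u ⟧ * c * ∑Ext V m (u ∷ b) Φ    ≡⟨ ℕ.*-assoc ⟦ admissible V b u ⟧ c _ ⟩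
      ⟦ admissible V b u ⟧ * (c * ∑Ext V m (u ∷ b) Φ)
        ≡⟨ cong (⟦ admissible V b u ⟧ *_) (*-distribˡ-∑Ext V m (u ∷ b) c Φ) ⟩
      ⟦ admissible V b u ⟧ * ∑Ext V m (u ∷ b) (λ t → c * Φ t) ∎)
      where open ≡-Reasoning

    ∑Ext-distrib-+ : ∀ V m b (Φ Ψ : List Point → ℕ) →
                     ∑Ext V m b (λ t → Φ t + Ψ t) ≡ ∑Ext V m b Φ + ∑Ext V m b Ψ
    ∑Ext-distrib-+ V zero    b Φ Ψ = refl
    ∑Ext-distrib-+ V (suc m) b Φ Ψ = trans (∑ᵛ-cong k λ u → trans
        (cong (⟦ admissible V b u ⟧ *_) (∑Ext-distrib-+ V m (u ∷ b) Φ Ψ)) (ℕ.*-distribˡ-+ ⟦ admissible V b u ⟧ _ _))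
      (∑ᵛ-distrib-+ k _ _)

    ∑Ext-sum : ∀ V m b {n} (Φ : Fin n → List Point → ℕ) →
               ∑Ext V m b (λ t → sum (λ x → Φ x t)) ≡ sum (λ x → ∑Ext V m b (Φ x))
    ∑Ext-sum V zero    b Φ = refl
    ∑Ext-sum V (suc m) b Φ = trans (∑ᵛ-cong k λ u → trans
        (cong (⟦ admissible V b u ⟧ *_) (∑Ext-sum V m (u ∷ b) Φ))
        (*-distribˡ-sum ⟦ admissible V b u ⟧ (λ x → ∑Ext V m (u ∷ b) (Φ x))))
      (∑ᵛ-comm-sum k λ u x → ⟦ admissible V b u ⟧ * ∑Ext V m (u ∷ b) (Φ x))

    ∑Ext-restrict : ∀ V H m b (Φ : List Point → ℕ) →
                    ∑Ext V m b (λ t → ⟦ all H t ⟧ * Φ t) ≡ ⟦ all H b ⟧ * ∑Ext (λ u → V u ∧ H u) m b Φ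
    ∑Ext-restrict V H zero    b Φ = refl
    ∑Ext-restrict V H (suc m) b Φ = trans (∑ᵛ-cong k λ u → trans
        (cong (⟦ admissible V b u ⟧ *_) (∑Ext-restrict V H m (u ∷ b) Φ))
        (⟦⟧-interchange (V u) (H u) (all H b) (rep (family b) u ≡ᵇ 0) _))
      (sym (*-distribˡ-∑ᵛ k ⟦ all H b ⟧ _))

    ∑Ext-mono : ∀ V m b {Φ Ψ : List Point → ℕ} → (∀ e → Extends V m b e → Ψ (e ʳ++ b) ≤ Φ (e ʳ++ b)) →
                ∑Ext V m b Ψ ≤ ∑Ext V m b Φ
    ∑Ext-mono V zero    b Ψ≤Φ = Ψ≤Φ [] tt
    ∑Ext-mono V (suc m) b Ψ≤Φ = ∑ᵛ-mono k λ u → ⟦⟧-*-mono (admissible V b u)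
      λ adm → ∑Ext-mono V m (u ∷ b) λ e ext → Ψ≤Φ (u ∷ e) (adm , ext)

    ∑Ext-cong-Extends : ∀ V m b {Φ Ψ : List Point → ℕ} → (∀ e → Extends V m b e → Φ (e ʳ++ b) ≡ Ψ (e ʳ++ b)) →
                        ∑Ext V m b Φ ≡ ∑Ext V m b Ψ
    ∑Ext-cong-Extends V m b Φ≡Ψ = ℕ.≤-antisym (∑Ext-mono V m b λ e ext → ℕ.≤-reflexive (Φ≡Ψ e ext))
                                              (∑Ext-mono V m b λ e ext → ℕ.≤-reflexive (sym (Φ≡Ψ e ext)))

    ∑Ext-≤-≡⇒≡ : ∀ V m b {Φ Ψ : List Point → ℕ} → (∀ e → Extends V m b e → Ψ (e ʳ++ b) ≤ Φ (e ʳ++ b)) →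
                 ∑Ext V m b Φ ≡ ∑Ext V m b Ψ → ∀ e → Extends V m b e → Φ (e ʳ++ b) ≡ Ψ (e ʳ++ b)
    ∑Ext-≤-≡⇒≡ V zero    b Ψ≤Φ ΣΦ≡ΣΨ [] tt = ΣΦ≡ΣΨ
    ∑Ext-≤-≡⇒≡ V (suc m) b {Φ} {Ψ} Ψ≤Φ ΣΦ≡ΣΨ (u ∷ e) (adm , ext) =
      ∑Ext-≤-≡⇒≡ V m (u ∷ b) (λ e ext → Ψ≤Φ (u ∷ e) (adm , ext)) at-u e ext
      where
      summands≤ : ∀ v → ⟦ admissible V b v ⟧ * ∑Ext V m (v ∷ b) Ψ ≤ ⟦ admissible V b v ⟧ * ∑Ext V m (v ∷ b) Φ
      summands≤ v = ⟦⟧-*-mono (admissible V b v) λ adm → ∑Ext-mono V m (v ∷ b) λ e ext → Ψ≤Φ (v ∷ e) (adm , ext)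
      at-u : ∑Ext V m (u ∷ b) Φ ≡ ∑Ext V m (u ∷ b) Ψ
      at-u = ℕ.*-cancelˡ-≡ _ _ 1 (subst (λ a → ⟦ a ⟧ * ∑Ext V m (u ∷ b) Φ ≡ ⟦ a ⟧ * ∑Ext V m (u ∷ b) Ψ) adm
                                        (∑ᵛ-≤-≡⇒≡ k summands≤ ΣΦ≡ΣΨ u))

    ∑Ext-count : ∀ {V r} → Subspace V → ∑ᵛ k (⟦_⟧ ∘ V) ≡ q ^ r →
                 ∀ m b → LinIndep F (family b) → all V b ≡ true → ∑Ext V m b (λ _ → 1) ≡ #extensions q r (length b) m
    ∑Ext-count V-closed #V zero    b indep b⊆V = refl
    ∑Ext-count {V} {r} V-closed #V (suc m) b indep b⊆V = begin
      ∑ᵛ k (λ u → ⟦ admissible V b u ⟧ * ∑Ext V m (u ∷ b) (λ _ → 1))   ≡⟨ ∑ᵛ-cong k recurse ⟩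
      ∑ᵛ k (λ u → ⟦ admissible V b u ⟧ * #extensions q r (suc (length b)) m)
        ≡⟨ ∑ᵛ-cong k (λ u → ℕ.*-comm ⟦ admissible V b u ⟧ _) ⟩
      ∑ᵛ k (λ u → #extensions q r (suc (length b)) m * ⟦ admissible V b u ⟧)
        ≡⟨ *-distribˡ-∑ᵛ k (#extensions q r (suc (length b)) m) (λ u → ⟦ admissible V b u ⟧) ⟨
      #extensions q r (suc (length b)) m * ∑ᵛ k (λ u → ⟦ admissible V b u ⟧)
        ≡⟨ cong (#extensions q r (suc (length b)) m *_) (∑ᵛ-admissible {r = r} V-closed #V b indep b⊆V) ⟩
      #extensions q r (suc (length b)) m * (q ^ r ∸ q ^ length b)
        ≡⟨ ℕ.*-comm _ (q ^ r ∸ q ^ length b) ⟩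
      (q ^ r ∸ q ^ length b) * #extensions q r (suc (length b)) m        ∎
      where
      open ≡-Reasoning
      recurse : ∀ u → ⟦ admissible V b u ⟧ * ∑Ext V m (u ∷ b) (λ _ → 1)
                    ≡ ⟦ admissible V b u ⟧ * #extensions q r (suc (length b)) m
      recurse u with admissible V b u in adm
      ... | false = refl
      ... | true  = cong (1 *_) (∑Ext-count V-closed #V m (u ∷ b)
                      (LinIndep-cons (family (u ∷ b)) indep (proj₂ (admissible⇒ V b u adm)))
                      (trans (cong (_∧ all V b) (proj₁ (admissible⇒ V b u adm))) b⊆V))

  kernel-size : ∀ {k n} (g : Fin (suc k) → Word F n) x t → (∃ λ j → g j x ≢ 0#) →
                ∑ᵛ (suc k) (λ u → ⟦ does (lincomb F (lookup u) g x ≟ t) ⟧) ≡ q ^ k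
  kernel-size {k} g x t nonzero with g zero x ≟ 0# | nonzero
  ... | no g₀≢0 | _ = begin
    ∑ᶜ (λ a → ∑ᵛ k λ v → ⟦ does (lincomb F (lookup (a ∷ v)) g x ≟ t) ⟧)
      ≡⟨ ∑ᵛ-comm-sum k (λ v i → ⟦ does (lincomb F (lookup (from i ∷ v)) g x ≟ t) ⟧) ⟨
    ∑ᵛ k (λ v → ∑ᶜ λ a → ⟦ does (lincomb F (lookup (a ∷ v)) g x ≟ t) ⟧)
      ≡⟨ ∑ᵛ-cong k exactlyOne ⟩
    ∑ᵛ k (λ _ → 1)
      ≡⟨ ∑ᵛ-const k 1 ⟩
    q ^ k * 1
      ≡⟨ ℕ.*-identityʳ _ ⟩
    q ^ k ∎
    where
    open ≡-Reasoning
    exactlyOne : ∀ v → ∑ᶜ (λ a → ⟦ does (lincomb F (lookup (a ∷ v)) g x ≟ t) ⟧) ≡ 1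
    exactlyOne v with affine-uniqueSolution g₀≢0 (lincomb F (lookup v) (g ∘ suc) x) t
    ... | a₀ , solution = trans (∑ᶜ-cong λ a → cong ⟦_⟧ (does-cong (solution a) (_ ≟ t) (a ≟ a₀)))
                                (∑ᶜ-δ a₀)
  ... | yes g₀≡0 | (zero , g₀≢0) = contradiction g₀≡0 g₀≢0
  kernel-size {suc k} g x t _ | yes g₀≡0 | (suc j , gⱼ≢0) =
    trans (∑ᶜ-cong λ a → trans (∑ᵛ-cong (suc k) (ignoreHead a)) (kernel-size (g ∘ suc) x t (j , gⱼ≢0)))
          (sum-const q _)
    where
    ignoreHead : ∀ a v → ⟦ does (lincomb F (lookup (a ∷ v)) g x ≟ t) ⟧
                       ≡ ⟦ does (lincomb F (lookup v) (g ∘ suc) x ≟ t) ⟧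
    ignoreHead a v = cong (λ s → ⟦ does (s ≟ t) ⟧) (lincomb-dropHead (lookup (a ∷ v)) g x g₀≡0)

  -- Support and weights of the code

  module _ {n k : ℕ} (G : Fin (suc k) → Word F n) where

    codeword : Point → Word F n
    codeword u = lincomb F (lookup u) G

    vanishesAt : Fin n → Point → Bool
    vanishesAt x u = does (codeword u x ≟ 0#)

    inSupport : Fin n → Bool
    inSupport x = not (does (Fin.all? λ j → G j x ≟ 0#))

    weight : List Point → ℕ
    weight t = sum λ x → ⟦ not (all (vanishesAt x) t) ⟧

    supportSize : ℕ
    supportSize = sum λ x → ⟦ inSupport x ⟧

    vanishingSupport : List Point → ℕ
    vanishingSupport t = sum λ x → ⟦ inSupport x ∧ all (vanishesAt x) t ⟧

    inSupport⇒nonzero : ∀ x → inSupport x ≡ true → ∃ λ j → G j x ≢ 0#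
    inSupport⇒nonzero x supp = Fin.¬∀⟶∃¬ (suc k) _ (λ j → G j x ≟ 0#)
      (does≡false⇒ (Fin.all? (λ j → G j x ≟ 0#)) (not-injective supp))

    outsideSupport⇒zeroColumn : ∀ x → inSupport x ≡ false → ∀ j → G j x ≡ 0#
    outsideSupport⇒zeroColumn x notSupp = does≡true⇒ (Fin.all? (λ j → G j x ≟ 0#)) (not-injective notSupp)

    outsideSupport⇒vanishes : ∀ x → inSupport x ≡ false → ∀ u → vanishesAt x u ≡ true
    outsideSupport⇒vanishes x notSupp u =
      dec-true (codeword u x ≟ 0#) (lincomb-vanishes (lookup u) G x (outsideSupport⇒zeroColumn x notSupp))

    vanishesAt-subspace : ∀ x → Subspace (vanishesAt x)
    vanishesAt-subspace x b u b⊆H (λs , u≈) = dec-true (codeword u x ≟ 0#) (begin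
      lincomb F (lookup u) G x                              ≡⟨ lincomb-cong {b = G} u≈ (λ _ _ → refl) x ⟩
      lincomb F (lincomb F λs (family b)) G x             ≡⟨ lincomb-lincomb λs (family b) G x ⟨
      lincomb F λs (λ l → codeword (List.lookup b l)) x
        ≡⟨ lincomb-vanishes λs (λ l → codeword (List.lookup b l)) x bₗ≡0 ⟩
      0#                                                    ∎)
      where
      open ≡-Reasoning
      bₗ≡0 : ∀ l → codeword (List.lookup b l) x ≡ 0#
      bₗ≡0 l = does≡true⇒ (_ ≟ 0#) (all-lookup b b⊆H l)

    ∑Ext-frames : ∀ m b → LinIndep F (family b) →
                  ∑Ext wholeSpace m b (λ _ → 1) ≡ #extensions q (suc k) (length b) m
    ∑Ext-frames m b indep = ∑Ext-count {k = suc k} {V = wholeSpace} (λ _ _ _ _ → refl)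
                                       (trans (∑ᵛ-const (suc k) 1) (ℕ.*-identityʳ (q ^ suc k)))
                                       m b indep (all-true (λ _ → refl) b)

    ∑Ext-const : ∀ m b → LinIndep F (family b) → ∀ d →
                 ∑Ext wholeSpace m b (λ _ → d) ≡ d * #extensions q (suc k) (length b) m
    ∑Ext-const m b indep d = begin
      ∑Ext wholeSpace m b (λ _ → d)        ≡⟨ ∑Ext-cong _ m b (λ _ → ℕ.*-identityʳ d) ⟨
      ∑Ext wholeSpace m b (λ _ → d * 1)    ≡⟨ *-distribˡ-∑Ext _ m b d (λ _ → 1) ⟨
      d * ∑Ext wholeSpace m b (λ _ → 1)    ≡⟨ cong (d *_) (∑Ext-frames m b indep) ⟩
      d * #extensions q (suc k) (length b) m     ∎
      where open ≡-Reasoning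

    ∑Ext-hyperplaneFrames : ∀ x → inSupport x ≡ true → ∀ m b → LinIndep F (family b) →
      ⟦ all (vanishesAt x) b ⟧ * ∑Ext (vanishesAt x) m b (λ _ → 1) ≡ ⟦ all (vanishesAt x) b ⟧ * #extensions q k (length b) m
    ∑Ext-hyperplaneFrames x supp m b indep with all (vanishesAt x) b in b⊆H
    ... | false = refl
    ... | true  = cong (1 *_) (∑Ext-count (vanishesAt-subspace x)
                    (kernel-size {k} {n} G x 0# (inSupport⇒nonzero x supp)) m b indep b⊆H)

    -- A frame covers x unless it lies in the hyperplane of words vanishing at x.
    ∑Ext-coordinate : ∀ x m b → LinIndep F (family b) →
      ∑Ext wholeSpace m b (λ t → ⟦ not (all (vanishesAt x) t) ⟧)
        + ⟦ inSupport x ∧ all (vanishesAt x) b ⟧ * #extensions q k (length b) m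
      ≡ ⟦ inSupport x ⟧ * #extensions q (suc k) (length b) m
    ∑Ext-coordinate x m b indep with inSupport x in supp
    ... | false = trans (ℕ.+-identityʳ _) (trans
                    (∑Ext-cong _ m b λ t → cong (⟦_⟧ ∘ not) (all-true (outsideSupport⇒vanishes x supp) t))
                    (sym (*-distribˡ-∑Ext _ m b 0 (λ _ → 0))))
    ... | true  = begin
      ∑Ext whole m b (λ t → ⟦ not (all H t) ⟧) + ⟦ all H b ⟧ * E′
        ≡⟨ cong (λ s → ∑Ext whole m b (λ t → ⟦ not (all H t) ⟧) + s) (∑Ext-hyperplaneFrames x supp m b indep) ⟨
      ∑Ext whole m b (λ t → ⟦ not (all H t) ⟧) + ⟦ all H b ⟧ * ∑Ext H m b (λ _ → 1)
        ≡⟨ cong (λ s → ∑Ext whole m b (λ t → ⟦ not (all H t) ⟧) + s) (∑Ext-restrict whole H m b (λ _ → 1)) ⟨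
      ∑Ext whole m b (λ t → ⟦ not (all H t) ⟧) + ∑Ext whole m b (λ t → ⟦ all H t ⟧ * 1)
        ≡⟨ ∑Ext-distrib-+ whole m b _ _ ⟨
      ∑Ext whole m b (λ t → ⟦ not (all H t) ⟧ + ⟦ all H t ⟧ * 1)
        ≡⟨ ∑Ext-cong whole m b (λ t → trans (cong (λ s → ⟦ not (all H t) ⟧ + s) (ℕ.*-identityʳ _))
                                            (⟦not⟧+⟦⟧ (all H t))) ⟩
      ∑Ext whole m b (λ _ → 1)
        ≡⟨ ∑Ext-frames m b indep ⟩
      E                                                     ≡⟨ ℕ.*-identityˡ E ⟨
      1 * E                                                 ∎
      where
      open ≡-Reasoning
      whole = wholeSpace
      H = vanishesAt x
      E = #extensions q (suc k) (length b) m
      E′ = #extensions q k (length b) m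

    ∑Ext-weight : ∀ m b → LinIndep F (family b) →
      ∑Ext wholeSpace m b weight + vanishingSupport b * #extensions q k (length b) m
      ≡ supportSize * #extensions q (suc k) (length b) m
    ∑Ext-weight m b indep = begin
      ∑Ext whole m b weight + vanishingSupport b * E′
        ≡⟨ cong₂ _+_ (∑Ext-sum whole m b (λ x t → ⟦ not (all (vanishesAt x) t) ⟧))
                     (*-distribʳ-sum E′ (λ x → ⟦ inSupport x ∧ all (vanishesAt x) b ⟧)) ⟩
      sum (λ x → ∑Ext whole m b (λ t → ⟦ not (all (vanishesAt x) t) ⟧))
        + sum (λ x → ⟦ inSupport x ∧ all (vanishesAt x) b ⟧ * E′)
        ≡⟨ ∑-distrib-+ (λ x → ∑Ext whole m b (λ t → ⟦ not (all (vanishesAt x) t) ⟧))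
                       (λ x → ⟦ inSupport x ∧ all (vanishesAt x) b ⟧ * E′) ⟨
      sum (λ x → ∑Ext whole m b (λ t → ⟦ not (all (vanishesAt x) t) ⟧) + ⟦ inSupport x ∧ all (vanishesAt x) b ⟧ * E′)
        ≡⟨ sum-cong-≗ (λ x → ∑Ext-coordinate x m b indep) ⟩
      sum (λ x → ⟦ inSupport x ⟧ * E)
        ≡⟨ *-distribʳ-sum E (λ x → ⟦ inSupport x ⟧) ⟨
      supportSize * E ∎
      where
      open ≡-Reasoning
      whole = wholeSpace
      E = #extensions q (suc k) (length b) m
      E′ = #extensions q k (length b) m

    vanishingSupport[] : vanishingSupport [] ≡ supportSize
    vanishingSupport[] = sum-cong-≗ λ x → cong ⟦_⟧ (∧-identityʳ (inSupport x))

    weight+vanishingSupport : ∀ t → weight t + vanishingSupport t ≡ supportSize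
    weight+vanishingSupport t = trans (sym (∑-distrib-+ (λ x → ⟦ not (all (vanishesAt x) t) ⟧)
                                                        (λ x → ⟦ inSupport x ∧ all (vanishesAt x) t ⟧)))
                                      (sum-cong-≗ coordinate)
      where
      coordinate : ∀ x → ⟦ not (all (vanishesAt x) t) ⟧ + ⟦ inSupport x ∧ all (vanishesAt x) t ⟧ ≡ ⟦ inSupport x ⟧
      coordinate x with inSupport x in supp
      ... | true  = ⟦not⟧+⟦⟧ (all (vanishesAt x) t)
      ... | false = cong (λ a → ⟦ not a ⟧ + 0) (all-true (outsideSupport⇒vanishes x supp) t)

    Supp-frame⇔ : ∀ t (b : Fin (length t) → Word F n) → (∀ l → b l ≈ codeword (List.lookup t l)) →
                  ∀ x → Supp (InSpan F b) x ⇔ not (all (vanishesAt x) t) ≡ true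
    Supp-frame⇔ t b b≈ x = mk⇔
      (λ supp → let l , bₗ≢0 = Equivalence.to (Supp-InSpan⇔ b x) supp
                in Equivalence.from (not-all⇔ (vanishesAt x) t)
                     (l , Equivalence.from (does≡false⇔ (_ ≟ 0#)) (bₗ≢0 ∘ trans (b≈ l x))))
      (λ notAll → let l , Hₗ≡false = Equivalence.to (not-all⇔ (vanishesAt x) t) notAll
                  in Equivalence.from (Supp-InSpan⇔ b x)
                       (l , Equivalence.to (does≡false⇔ (_ ≟ 0#)) Hₗ≡false ∘ trans (sym (b≈ l x))))

    weight-HasWeight : ∀ t → HasWeight F (InSpan F (codeword ∘ List.lookup t)) (weight t)
    weight-HasWeight t = HasWeight-sum (λ x → not (all (vanishesAt x) t)) (Supp-frame⇔ t _ λ _ _ → refl)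

    HasWeight⇒≡weight : ∀ t (b : Fin (length t) → Word F n) → (∀ l → b l ≈ codeword (List.lookup t l)) →
                        ∀ {w} → HasWeight F (InSpan F b) w → w ≡ weight t
    HasWeight⇒≡weight t b b≈ = HasWeight⇒≡sum (λ x → not (all (vanishesAt x) t)) (Supp-frame⇔ t b b≈)

    LinIndep-coefficients : ∀ {r} (μ : Fin r → Word F (suc k)) (b : Fin r → Word F n) →
                            (∀ l → b l ≈ lincomb F (μ l) G) → LinIndep F b → LinIndep F μ
    LinIndep-coefficients μ b b≈ indep λs Σ≈0 = indep λs λ x → begin
      lincomb F λs b x                             ≡⟨ lincomb-cong (λ _ → refl) b≈ x ⟩
      lincomb F λs (λ l → lincomb F (μ l) G) x     ≡⟨ lincomb-lincomb λs μ G x ⟩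
      lincomb F (lincomb F λs μ) G x               ≡⟨ lincomb-cong {b = G} Σ≈0 (λ _ _ → refl) x ⟩
      lincomb F (λ _ → 0#) G x                     ≡⟨ lincomb-zero G x ⟩
      0#                                           ∎
      where open ≡-Reasoning

    module _ (G-indep : LinIndep F G) where

      LinIndep-codewords : ∀ {r} (μ : Fin r → Word F (suc k)) → LinIndep F μ → LinIndep F (λ l → lincomb F (μ l) G)
      LinIndep-codewords μ indep λs Σ≈0 =
        indep λs (G-indep (lincomb F λs μ) λ x → trans (sym (lincomb-lincomb λs μ G x)) (Σ≈0 x))

      higherWeight≤weight : ∀ {r dᵣ} → IsHigherWeight F G r dᵣ → ∀ t → length t ≡ r → LinIndep F (family t) →
                            dᵣ ≤ weight t
      higherWeight≤weight (_ , minimal) t refl indep =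
        minimal (codeword ∘ List.lookup t) (weight t)
                ((λ l → lookup (List.lookup t l) , λ _ → refl) , LinIndep-codewords (family t) indep)
                (weight-HasWeight t)

    dₖ≡supportSize : ∀ {dₖ} → IsHigherWeight F G (suc k) dₖ → dₖ ≡ supportSize
    dₖ≡supportSize ((b , (b∈C , indep) , hasWeight) , _) = HasWeight⇒≡sum inSupport supp⇔ hasWeight
      where
      μ = proj₁ ∘ b∈C
      b≈ = proj₂ ∘ b∈C
      spanning = LinIndep⇒spanning μ (LinIndep-coefficients μ b b≈ indep)
      nonzeroIn : ∀ x → ∃ (λ l → b l x ≢ 0#) → inSupport x ≡ true
      nonzeroIn x (l , bₗ≢0) with inSupport x in supp
      ... | true  = refl
      ... | false = contradiction (trans (b≈ l x) (lincomb-vanishes (μ l) G x (outsideSupport⇒zeroColumn x supp))) bₗ≢0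
      -- Gⱼ is itself a combination of the codewords b l, since the coefficient words μ l span.
      column≡0 : ∀ x j → (∀ l → b l x ≡ 0#) → G j x ≡ 0#
      column≡0 x j b≡0 with spanning (unit j)
      ... | λs , unit≈ = begin
        G j x                                        ≡⟨ lincomb-unit j G x ⟨
        lincomb F (unit j) G x                     ≡⟨ lincomb-cong {b = G} unit≈ (λ _ _ → refl) x ⟩
        lincomb F (lincomb F λs μ) G x               ≡⟨ lincomb-lincomb λs μ G x ⟨
        lincomb F λs (λ l → lincomb F (μ l) G) x
          ≡⟨ lincomb-vanishes λs (λ l → lincomb F (μ l) G) x (λ l → trans (sym (b≈ l x)) (b≡0 l)) ⟩
        0#                                           ∎
        where open ≡-Reasoning
      supp⇔ : ∀ x → Supp (InSpan F b) x ⇔ inSupport x ≡ true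
      supp⇔ x = mk⇔ (nonzeroIn x ∘ Equivalence.to (Supp-InSpan⇔ b x)) λ supp →
        let j , Gⱼ≢0 = inSupport⇒nonzero x supp
        in Equivalence.from (Supp-InSpan⇔ b x)
             (Fin.¬∀⟶∃¬ (suc k) _ (λ l → b l x ≟ 0#) (Gⱼ≢0 ∘ column≡0 x j))

  -- The two counting arguments

  module _ {n : ℕ} (i s : ℕ) (G : Fin (suc (i + s)) → Word F n) (G-indep : LinIndep F G) where

    -- The average weight of the i-frames already equals the minimum dᵢ, so every i-frame attains it.
    frameWeight≡dᵢ : ∀ {dᵢ} → IsHigherWeight F G i dᵢ →
      supportSize G * (q ^ suc s * (q ^ i ∸ 1)) ≡ (q ^ suc (i + s) ∸ 1) * dᵢ →
      ∀ e → Extends wholeSpace i [] e → weight G (e ʳ++ []) ≡ dᵢ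
    frameWeight≡dᵢ {dᵢ} hᵢ hyp =
      ∑Ext-≤-≡⇒≡ wholeSpace i [] dᵢ≤weight (trans total (sym (∑Ext-const G i [] indep dᵢ)))
      where
      indep : LinIndep F (family [])
      indep _ _ ()
      dᵢ≤weight : ∀ e → Extends wholeSpace i [] e → dᵢ ≤ weight G (e ʳ++ [])
      dᵢ≤weight e ext = higherWeight≤weight G G-indep hᵢ (e ʳ++ [])
        (trans (length-ʳ++ e) (trans (ℕ.+-identityʳ _) (Extends⇒length i e ext))) (Extends⇒LinIndep i e indep ext)
      total : ∑Ext wholeSpace i [] (weight G) ≡ dᵢ * #extensions q (suc (i + s)) 0 i
      total = cancel-frameCounts 1<q i s {d = supportSize G} {dᵢ}
        (trans (cong (λ z → ∑Ext wholeSpace i [] (weight G) + z * #extensions q (i + s) 0 i)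
                     (sym (vanishingSupport[] G)))
               (∑Ext-weight G i [] indep))
        (#extensions-hyperplane q i s) hyp

  module _ {n : ℕ} (i′ s : ℕ) (G : Fin (suc (suc i′ + s)) → Word F n) (G-indep : LinIndep F G) where

    -- Counting the i-frames that start with c, coordinate by coordinate, now determines the weight of c.
    codewordWeight : ∀ {dᵢ} → IsHigherWeight F G (suc i′) dᵢ →
      supportSize G * (q ^ suc s * (q ^ suc i′ ∸ 1)) ≡ (q ^ suc (suc i′ + s) ∸ 1) * dᵢ →
      ∀ c → InSpan F G c → ¬ c ≈ zeroW F → ∀ w → CodewordWeight F c w →
      w * (q ^ suc (suc i′ + s) ∸ 1) ≡ supportSize G * (q ^ suc (i′ + s) * (q ∸ 1))
    codewordWeight {dᵢ} hᵢ hyp c (λc , c≈) c≢0 w hasWeight =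
      solve-codewordWeight 1<q i′ s {d = supportSize G} {dᵢ} {w} {vanishingSupport G [ u ]} {M} {#extensions q (suc i′ + s) 1 i′}
        (#extensions≢0 q 1<q (suc (suc i′ + s)) 1 i′ (ℕ.m≤n⇒m≤1+n (s≤s (ℕ.m≤m+n i′ s))))
        h₁ h₂ (#extensions-hyperplane₁ q i′ s) hyp
      where
      u = tabulate λc
      c≈u : c ≈ codeword G u
      c≈u x = trans (c≈ x) (lincomb-cong {b = G} (λ j → sym (lookup∘tabulate λc j)) (λ _ _ → refl) x)
      u-admissible : admissible wholeSpace [] u ≡ true
      u-admissible = ¬InSpan⇒admissible wholeSpace [] u refl λ (_ , u≈0) →
        c≢0 λ x → trans (c≈u x) (trans (lincomb-cong {b = G} u≈0 (λ _ _ → refl) x) (lincomb-zero G x))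
      indep : LinIndep F (family [ u ])
      indep = Extends⇒LinIndep {V = wholeSpace} 1 {b = []} [ u ] (λ _ _ ()) (u-admissible , tt)
      M = #extensions q (suc (suc i′ + s)) 1 i′
      allFrames : ∑Ext wholeSpace i′ [ u ] (weight G) ≡ dᵢ * M
      allFrames = trans (∑Ext-cong-Extends wholeSpace i′ [ u ] {weight G} {λ _ → dᵢ} frameWeight)
                        (∑Ext-const G i′ [ u ] indep dᵢ)
        where
        frameWeight : ∀ e → Extends wholeSpace i′ [ u ] e → weight G (e ʳ++ [ u ]) ≡ dᵢ
        frameWeight e ext = frameWeight≡dᵢ (suc i′) s G G-indep hᵢ hyp (u ∷ e) (u-admissible , ext)
      h₁ : dᵢ * M + vanishingSupport G [ u ] * #extensions q (suc i′ + s) 1 i′ ≡ supportSize G * M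
      h₁ = trans (cong (_+ vanishingSupport G [ u ] * #extensions q (suc i′ + s) 1 i′) (sym allFrames))
           (∑Ext-weight G i′ [ u ] indep)
      h₂ : w + vanishingSupport G [ u ] ≡ supportSize G
      h₂ = trans (cong (_+ vanishingSupport G [ u ]) (HasWeight⇒≡weight G [ u ] (λ _ → c) (λ { zero → c≈u }) hasWeight))
                 (weight+vanishingSupport G [ u ])

proposition1 : (F : FiniteField) → (n k : ℕ) → (G : Fin k → Word F n) → LinIndep F G →
    (i dᵢ dₖ : ℕ) → 1 ≤ i → i < k →
    IsHigherWeight F G i dᵢ → IsHigherWeight F G k dₖ →
    dₖ * (FiniteField.q F ^ (k ∸ i) * (FiniteField.q F ^ i ∸ 1)) ≡ (FiniteField.q F ^ k ∸ 1) * dᵢ →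
    ∀ (c : Word F n) → InSpan F G c → ¬ (_≈W_ F c (zeroW F)) →
    ∀ (w : ℕ) → CodewordWeight F c w →
    w * (FiniteField.q F ^ k ∸ 1) ≡ dₖ * (FiniteField.q F ^ (k ∸ 1) * (FiniteField.q F ∸ 1))
proposition1 F n k G G-indep (suc i′) dᵢ dₖ (s≤s z≤n) i<k hᵢ hₖ hyp c c∈C c≢0 w hasWeight
  with ℕ.m≤n⇒∃[o]m+o≡n i<k
... | s , refl = begin
  w * (q ^ suc (suc i′ + s) ∸ 1)                    ≡⟨ codewordWeight F i′ s G G-indep hᵢ hypₛ c c∈C c≢0 w hasWeight ⟩
  supportSize F G * (q ^ suc (i′ + s) * (q ∸ 1))    ≡⟨ cong (_* (q ^ suc (i′ + s) * (q ∸ 1))) dₖ≡ ⟨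
  dₖ * (q ^ suc (i′ + s) * (q ∸ 1))                 ∎
  where
  open ≡-Reasoning
  q = FiniteField.q F
  dₖ≡ : dₖ ≡ supportSize F G
  dₖ≡ = dₖ≡supportSize F G hₖ
  k∸i≡ : suc (i′ + s) ∸ i′ ≡ suc s
  k∸i≡ = trans (cong (_∸ i′) (sym (ℕ.+-suc i′ s))) (ℕ.m+n∸m≡n i′ (suc s))
  hypₛ : supportSize F G * (q ^ suc s * (q ^ suc i′ ∸ 1)) ≡ (q ^ suc (suc i′ + s) ∸ 1) * dᵢ
  hypₛ = subst₂ (λ d e → d * (q ^ e * (q ^ suc i′ ∸ 1)) ≡ (q ^ suc (suc i′ + s) ∸ 1) * dᵢ) dₖ≡ k∸i≡ hyp
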